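{- Let $n\ge1$, $\sigma\in\mathrm{CCP}_{2n}$ and $P\in\mathcal{D}_n$. The permutation $\tau$ produced by the Inverse Algorithm on input $(P,\sigma)$ is a non-crossing pairing permutation; hence $\tau$ is the tunneling of some Dyck path $Q\in\mathcal{D}_n$.
   Context: A Dyck path of size $n$ is a word $P_1\cdots P_{2n}$ in $\mathtt{u},\mathtt{d}$ with $n$ of each letter whose every prefix has at least as many $\mathtt{u}$'s as $\mathtt{d}$'s; $\mathcal{D}_n$ is their set. The tunneling $\tau_Q\in S_{2n}$ of $Q\in\mathcal{D}_n$ is the fixed-point-free involution pairing each up-step position with the position of its matching down-step. Arithmetic on $[2n]$ is modulo $2n$. A set $X\subseteq[2n]$ is a block of size $k$ if $X=\{x,x+1,\dots,x+k-1\}$ (mod $2n$) for some $x$; $x$ and $x+k-1$ are its endpoints. A pairing permutation of $[2n]$ is a fixed-point-free involution $\tau$. For $a,b\in[2n]$, $(a,b)$ is $\tau$-non-crossing if for any block $C$ with endpoints $a$ and $b$, $\tau(c)\in C$ for all $c\in C$; $\tau$ is non-crossing if $(c,\tau(c))$ is $\tau$-non-crossing for every $c\in[2n]$. (A pairing permutation is the tunneling of a Dyck path iff it is non-crossing.) $\sigma\in S_{2n}$ is a CCP if $\sigma_{[k]}=\{\sigma(1),\dots,\sigma(k)\}$ is a block of size $k$ for every $k$; $\mathrm{CCP}_{2n}$ is their set. Inverse Algorithm (input $P$, $\sigma\in\mathrm{CCP}_{2n}$): initially all elements of $[2n]$ are unpaired. For each $k\in[2n]$ with $P_k=\mathtt{d}$,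 in increasing order: (1) let $w$ be an endpoint of the block $\sigma_{[k-1]}$ cyclically adjacent to $\sigma_k$; (2) starting from $w$, traverse the block $\sigma_{[k-1]}$ (away from $\sigma_k$) to the first unpaired element $v$; (3) set $\tau(\sigma_k)=v$, $\tau(v)=\sigma_k$; (4) mark $\sigma_k,v$ paired. Output $\tau$. -}

module Defs where

open import Data.Nat using (ℕ; zero; suc; _+_; _*_; _∸_; _≤_; _<_; _<?_; _%_; _≡ᵇ_)
open import Data.Bool using (Bool; true; false; if_then_else_; _∨_)
open import Data.Fin using (Fin; toℕ; fromℕ<)
open import Data.Fin.Permutation using (Permutation′; _⟨$⟩ʳ_)
open import Data.List using (List; []; _∷_; map; upTo; foldl; take)
open import Data.Bool.ListAction using (any)
open import Data.Maybe using (Maybe; just; nothing)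
open import Data.Product using (Σ; ∃; _×_; _,_)
open import Data.Sum using (_⊎_)
open import Function.Bundles using (_⇔_)
open import Relation.Nullary using (¬_; yes; no)
open import Relation.Binary.PropositionalEquality using (_≡_)

-- Conventions: [2n] is represented by Fin (2 * n), i.e. {0,…,2n-1}
-- (element i of Fin corresponds to i+1 of the paper); positions of a
-- word are likewise 0-indexed.  Arithmetic is modulo m = 2n.

_mod_ : ℕ → ℕ → ℕ
x mod zero  = x
x mod suc m = x % suc m

data Step : Set where
  u d : Step

count : Step → List Step → ℕ
count s [] = 0
count u (u ∷ w) = suc (count u w)
count u (d ∷ w) = count u w
count d (u ∷ w) = count d w
count d (d ∷ w) = suc (count d w)

IsDyck : ℕ → List Step → Set
IsDyck n P = count u P ≡ n × count d P ≡ n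
           × (∀ k → count d (take k P) ≤ count u (take k P))

letterAt : List Step → ℕ → Step
letterAt []      _       = u
letterAt (s ∷ _) zero    = s
letterAt (_ ∷ w) (suc k) = letterAt w k

-- Partial pairings recorded as lists of pairs, and conversion to
-- functions on Fin m (unpaired elements are sent to themselves).

partnerOf : List (ℕ × ℕ) → ℕ → Maybe ℕ
partnerOf [] x = nothing
partnerOf ((a , b) ∷ ps) x =
  if a ≡ᵇ x then just b else (if b ≡ᵇ x then just a else partnerOf ps x)

isPaired : List (ℕ × ℕ) → ℕ → Bool
isPaired ps x with partnerOf ps x
... | just _  = true
... | nothing = false

toFinOr : {m : ℕ} → Maybe ℕ → Fin m → Fin m
toFinOr {m} (just y) i with y <? m
... | yes y<m = fromℕ< y<m
... | no  _   = i
toFinOr nothing i = i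

pairsToFun : {m : ℕ} → List (ℕ × ℕ) → Fin m → Fin m
pairsToFun ps i = toFinOr (partnerOf ps (toℕ i)) i

-- Tunneling of a Dyck path: each up-step is paired with its matching
-- down-step (standard stack matching).

tunnelPairs : List Step → ℕ → List ℕ → List (ℕ × ℕ)
tunnelPairs []      p st       = []
tunnelPairs (u ∷ w) p st       = tunnelPairs w (suc p) (p ∷ st)
tunnelPairs (d ∷ w) p []       = tunnelPairs w (suc p) []
tunnelPairs (d ∷ w) p (q ∷ st) = (q , p) ∷ tunnelPairs w (suc p) st

tunneling : {m : ℕ} → List Step → Fin m → Fin m
tunneling Q = pairsToFun (tunnelPairs Q 0 [])

InBlock : {m : ℕ} → Fin m → ℕ → Fin m → Set
InBlock {m} x k y = ∃ λ j → j < k × toℕ y ≡ (toℕ x + j) mod m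

IsBlockOfSize : {m : ℕ} → (Fin m → Set) → ℕ → Set
IsBlockOfSize {m} X k = ∃ λ (x : Fin m) → ∀ y → (X y ⇔ InBlock x k y)

InPrefix : {m : ℕ} → Permutation′ m → ℕ → Fin m → Set
InPrefix {m} σ k y = ∃ λ (i : Fin m) → toℕ i < k × σ ⟨$⟩ʳ i ≡ y

IsCCP : {m : ℕ} → Permutation′ m → Set
IsCCP {m} σ = ∀ k → 1 ≤ k → k ≤ m → IsBlockOfSize (InPrefix σ k) k

IsPairing : {m : ℕ} → (Fin m → Fin m) → Set
IsPairing τ = (∀ i → ¬ (τ i ≡ i)) × (∀ i → τ (τ i) ≡ i)

-- (a,b) is τ-non-crossing: every block C with endpoints a and b
-- (i.e. C = {x,…,x+k-1} with {x, x+k-1} = {a, b}) is τ-closed.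
NonCrossingPair : {m : ℕ} → (Fin m → Fin m) → Fin m → Fin m → Set
NonCrossingPair {m} τ a b =
  ∀ (x : Fin m) (k : ℕ) → 1 ≤ k → k ≤ m →
  ((toℕ x ≡ toℕ a × (toℕ x + (k ∸ 1)) mod m ≡ toℕ b)
     ⊎ (toℕ x ≡ toℕ b × (toℕ x + (k ∸ 1)) mod m ≡ toℕ a)) →
  ∀ c → InBlock x k c → InBlock x k (τ c)

NonCrossing : {m : ℕ} → (Fin m → Fin m) → Set
NonCrossing τ = ∀ c → NonCrossingPair τ c (τ c)

-- σ applied to a natural number index (0 outside range; never used there)
appℕ : {m : ℕ} → Permutation′ m → ℕ → ℕ
appℕ {m} σ i with i <? m
... | yes i<m = toℕ (σ ⟨$⟩ʳ fromℕ< i<m)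
... | no  _   = 0

firstUnpaired : List (ℕ × ℕ) → List ℕ → Maybe ℕ
firstUnpaired ps [] = nothing
firstUnpaired ps (v ∷ vs) = if isPaired ps v then firstUnpaired ps vs else just v

-- step for position k (0-indexed; paper's k+1) with P_k = d.
-- The block σ_[k-1] of the paper is {σ(0),…,σ(k-1)} here (size k).
-- If σ(k)+1 lies in it, it is the endpoint adjacent to σ(k) and the
-- block is traversed upwards σ(k)+1, σ(k)+2, …; otherwise the adjacent
-- endpoint is σ(k)-1 and the block is traversed downwards.
invStep : {m : ℕ} → Permutation′ m → List (ℕ × ℕ) → ℕ → List (ℕ × ℕ)
invStep {m} σ ps k =
  let s      = appℕ σ k
      prefix = map (appℕ σ) (upTo k)
      up     = (suc s) mod m
      route  = if any (λ y → y ≡ᵇ up) prefix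
                 then map (λ j → (suc s + j) mod m) (upTo k)
                 else map (λ j → (s + (m ∸ suc j)) mod m) (upTo k)
  in  firstUnpairedAdd (firstUnpaired ps route) s
  where
    firstUnpairedAdd : Maybe ℕ → ℕ → List (ℕ × ℕ)
    firstUnpairedAdd (just v) s = (s , v) ∷ ps
    firstUnpairedAdd nothing  s = ps

invLoop : {m : ℕ} → List Step → Permutation′ m → List (ℕ × ℕ) → ℕ → List (ℕ × ℕ)
invLoop P σ ps k with letterAt P k
... | u = ps
... | d = invStep σ ps k

inverseAlgorithm : {m : ℕ} → List Step → Permutation′ m → Fin m → Fin m
inverseAlgorithm {m} P σ = pairsToFun (foldl (invLoop P σ) [] (upTo m))

-- Rotate ℤ/2n so that the block σ_[2n-1] becomes 1, …, 2n-1.  Since σ is a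
-- CCP, every σ_[k] with k < 2n is then an interval [l, l + k) that does not
-- wrap around, and σ(k+1) lies next to it, at l - 1 or at l + k.  The step for
-- P_{k+1} = d walks from σ(k+1) into this interval and pairs it with the first
-- unpaired point v; every point passed over is already paired, and by induction
-- its partner also lies between σ(k+1) and v, so the arcs stay nested.  The
-- unpaired points of σ_[k] always number #u - #d of P_1 ⋯ P_k, so the Dyck
-- condition guarantees that v exists and that nothing is left unpaired.  Arcs
-- nested in a rotated order are non-crossing in the cyclic sense, and a
-- non-crossing pairing τ is the tunneling of the Dyck path with an up-step
-- exactly at the positions c < τ(c).

module Submission where

open import Defs
open import Data.Nat
open import Data.Nat.Properties
open import Data.Nat.DivMod
  using (_/_; m%n<n; m<n⇒m%n≡m; m≤n⇒[n∸m]%m≡n%m; %-distribˡ-+; m%n%n≡m%n; [m+n]%n≡m%n; [m+kn]%n≡m%n;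
         m≡m%n+[m/n]*n; n%n≡0)
open import Data.Bool using (Bool; true; false; if_then_else_; _∨_)
open import Data.Bool.Properties using (∨-zeroʳ; not-¬)
open import Data.Bool.ListAction using (any)
open import Data.Maybe using (just; nothing)
open import Data.Maybe.Properties using (just-injective)
open import Data.List using (List; []; _∷_; [_]; _++_; map; upTo; applyUpTo; foldl; take; length)
open import Data.List.Properties using (map-upTo; foldl-∷ʳ; upTo-∷ʳ; take-all)
open import Data.List.Membership.Propositional using (_∈_)
open import Data.List.Relation.Unary.All as All using (All)
open import Data.List.Relation.Unary.AllPairs using (AllPairs; []; _∷_)
open import Data.List.Relation.Unary.Any using (here; there)
open import Data.Fin using (Fin; toℕ; fromℕ<)
open import Data.Fin.Properties using (toℕ-injective; toℕ<n; fromℕ<-toℕ; toℕ-fromℕ<)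
open import Data.Fin.Permutation using (Permutation′; _⟨$⟩ʳ_; _⟨$⟩ˡ_; inverseˡ; inverseʳ)
open import Data.Product using (Σ; ∃; _×_; _,_; proj₁; proj₂)
open import Data.Sum using (_⊎_; inj₁; inj₂; map₂) renaming (map to map-⊎)
open import Data.Empty using (⊥-elim)
open import Function.Base using (_∘_)
open import Function.Bundles using (Equivalence)
open import Relation.Nullary using (¬_; Dec; yes; no; does)
open import Relation.Nullary.Decidable using (dec-true; dec-false)
open import Relation.Binary.Definitions using (tri<; tri≈; tri>)
open import Relation.Binary.PropositionalEquality hiding ([_])
open import Data.Nat.Tactic.RingSolver using (solve-∀)

Pairs : Set
Pairs = List (ℕ × ℕ)

-- partnerOf tests a ≡ᵇ x, which is definitionally does (a ≟ x).
partnerOf-fst : ∀ a b (ps : Pairs) → partnerOf ((a , b) ∷ ps) a ≡ just b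
partnerOf-fst a b ps =
  cong (if_then just b else (if does (b ≟ a) then just a else partnerOf ps a)) (dec-true (a ≟ a) refl)

partnerOf-snd : ∀ {a b} (ps : Pairs) → a ≢ b → partnerOf ((a , b) ∷ ps) b ≡ just a
partnerOf-snd {a} {b} ps a≢b =
  trans (cong (if_then just b else (if does (b ≟ b) then just a else partnerOf ps b)) (dec-false (a ≟ b) a≢b))
        (cong (if_then just a else partnerOf ps b) (dec-true (b ≟ b) refl))

partnerOf-other : ∀ {a b x} (ps : Pairs) → a ≢ x → b ≢ x → partnerOf ((a , b) ∷ ps) x ≡ partnerOf ps x
partnerOf-other {a} {b} {x} ps a≢x b≢x =
  trans (cong (if_then just b else (if does (b ≟ x) then just a else partnerOf ps x)) (dec-false (a ≟ x) a≢x))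
        (cong (if_then just a else partnerOf ps x) (dec-false (b ≟ x) b≢x))

partnerOf-∷-inv : ∀ {a b x z} (ps : Pairs) → partnerOf ((a , b) ∷ ps) x ≡ just z →
                  (x ≡ a × z ≡ b) ⊎ (x ≡ b × z ≡ a) ⊎ partnerOf ps x ≡ just z
partnerOf-∷-inv {a} {b} {x} {z} ps = view (a ≟ x) (b ≟ x)
  where
  view : (a≟x : Dec (a ≡ x)) (b≟x : Dec (b ≡ x)) →
         (if does a≟x then just b else if does b≟x then just a else partnerOf ps x) ≡ just z →
         (x ≡ a × z ≡ b) ⊎ (x ≡ b × z ≡ a) ⊎ partnerOf ps x ≡ just z
  view (yes refl) _          refl = inj₁ (refl , refl)
  view (no _)     (yes refl) refl = inj₂ (inj₁ (refl , refl))
  view (no _)     (no _)     e    = inj₂ (inj₂ e)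

nothing≢just : ∀ {z : ℕ} → nothing ≢ just z
nothing≢just ()

partnerOf≡nothing⇒unpaired : ∀ ps x → partnerOf ps x ≡ nothing → isPaired ps x ≡ false
partnerOf≡nothing⇒unpaired ps x e with partnerOf ps x
... | nothing = refl

partnerOf≡just⇒paired : ∀ ps x {z} → partnerOf ps x ≡ just z → isPaired ps x ≡ true
partnerOf≡just⇒paired ps x e with partnerOf ps x
... | just _ = refl

unpaired⇒partnerOf≡nothing : ∀ ps x → isPaired ps x ≡ false → partnerOf ps x ≡ nothing
unpaired⇒partnerOf≡nothing ps x e with partnerOf ps x
... | nothing = refl

paired⇒partnerOf≡just : ∀ ps x → isPaired ps x ≡ true → ∃ λ z → partnerOf ps x ≡ just z
paired⇒partnerOf≡just ps x e with partnerOf ps x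
... | just z = z , refl

isPaired-cong : ∀ ps ps' x → partnerOf ps x ≡ partnerOf ps' x → isPaired ps x ≡ isPaired ps' x
isPaired-cong ps ps' x e with partnerOf ps x | partnerOf ps' x
... | just _  | just _  = refl
... | nothing | nothing = refl
... | just _  | nothing = ⊥-elim (nothing≢just (sym e))
... | nothing | just _  = ⊥-elim (nothing≢just e)

record FirstUnpaired (ps : Pairs) (f : ℕ → ℕ) (k : ℕ) : Set where
  field
    index          : ℕ
    index<k        : index < k
    found          : firstUnpaired ps (applyUpTo f k) ≡ just (f index)
    unpaired       : isPaired ps (f index) ≡ false
    earlier-paired : ∀ i → i < index → isPaired ps (f i) ≡ true

firstUnpaired-∷-unpaired : ∀ {ps v} vs → isPaired ps v ≡ false → firstUnpaired ps (v ∷ vs) ≡ just v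
firstUnpaired-∷-unpaired {ps} {v} vs = cong (if_then firstUnpaired ps vs else just v)

firstUnpaired-∷-paired : ∀ {ps v} vs → isPaired ps v ≡ true → firstUnpaired ps (v ∷ vs) ≡ firstUnpaired ps vs
firstUnpaired-∷-paired {ps} {v} vs = cong (if_then firstUnpaired ps vs else just v)

firstUnpaired-applyUpTo : ∀ ps f k j → j < k → isPaired ps (f j) ≡ false → FirstUnpaired ps f k
firstUnpaired-applyUpTo ps f (suc k) j j<k fj with isPaired ps (f 0) in f0
... | false = record
  { index = 0 ; index<k = s≤s z≤n ; unpaired = f0 ; earlier-paired = λ _ ()
  ; found = firstUnpaired-∷-unpaired (applyUpTo (f ∘ suc) k) f0 }
firstUnpaired-applyUpTo ps f (suc k) zero    j<k fj | true = ⊥-elim (not-¬ f0 fj)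
firstUnpaired-applyUpTo ps f (suc k) (suc j) j<k fj | true = record
  { index = suc index ; index<k = s≤s index<k ; unpaired = unpaired ; earlier-paired = earlier
  ; found = trans (firstUnpaired-∷-paired (applyUpTo (f ∘ suc) k) f0) found }
  where
  open FirstUnpaired (firstUnpaired-applyUpTo ps (f ∘ suc) k j (≤-pred j<k) fj)
  earlier : ∀ i → i < suc index → isPaired ps (f i) ≡ true
  earlier zero    _         = f0
  earlier (suc i) (s≤s i<j) = earlier-paired i i<j

any-applyUpTo-true : ∀ (f : ℕ → ℕ) c k j → j < k → f j ≡ c → any (λ y → y ≡ᵇ c) (applyUpTo f k) ≡ true
any-applyUpTo-true f c (suc k) zero    _   f0≡c =
  cong (_∨ any (λ y → y ≡ᵇ c) (applyUpTo (f ∘ suc) k)) (dec-true (f 0 ≟ c) f0≡c)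
any-applyUpTo-true f c (suc k) (suc j) j<k fj≡c =
  trans (cong ((f 0 ≡ᵇ c) ∨_) (any-applyUpTo-true (f ∘ suc) c k j (≤-pred j<k) fj≡c)) (∨-zeroʳ (f 0 ≡ᵇ c))

any-applyUpTo-false : ∀ (f : ℕ → ℕ) c k → (∀ j → j < k → f j ≢ c) →
                      any (λ y → y ≡ᵇ c) (applyUpTo f k) ≡ false
any-applyUpTo-false f c zero    _  = refl
any-applyUpTo-false f c (suc k) ne =
  trans (cong (_∨ any (λ y → y ≡ᵇ c) (applyUpTo (f ∘ suc) k)) (dec-false (f 0 ≟ c) (ne 0 (s≤s z≤n))))
        (any-applyUpTo-false (f ∘ suc) c k (λ j j<k → ne (suc j) (s≤s j<k)))

toℕ-pairsToFun : ∀ {m} ps (i : Fin m) {z} → partnerOf ps (toℕ i) ≡ just z → z < m → toℕ (pairsToFun ps i) ≡ z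
toℕ-pairsToFun {m} ps i {z} e z<m rewrite e with z <? m
... | yes z<m' = toℕ-fromℕ< z<m'
... | no  z≮m  = ⊥-elim (z≮m z<m)

count-∷ : ∀ s x w → count s (x ∷ w) ≡ count s [ x ] + count s w
count-∷ u u w = refl
count-∷ u d w = refl
count-∷ d u w = refl
count-∷ d d w = refl

count-++ : ∀ s xs ys → count s (xs ++ ys) ≡ count s xs + count s ys
count-++ s []       ys = refl
count-++ s (x ∷ xs) ys = begin
  count s (x ∷ (xs ++ ys))                  ≡⟨ count-∷ s x (xs ++ ys) ⟩
  count s [ x ] + count s (xs ++ ys)         ≡⟨ cong (count s [ x ] +_) (count-++ s xs ys) ⟩
  count s [ x ] + (count s xs + count s ys)  ≡⟨ +-assoc (count s [ x ]) _ _ ⟨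
  count s [ x ] + count s xs + count s ys    ≡⟨ cong (_+ count s ys) (count-∷ s x xs) ⟨
  count s (x ∷ xs) + count s ys              ∎
  where open ≡-Reasoning

count-u+count-d : ∀ w → count u w + count d w ≡ length w
count-u+count-d []      = refl
count-u+count-d (u ∷ w) = cong suc (count-u+count-d w)
count-u+count-d (d ∷ w) = trans (+-suc (count u w) (count d w)) (cong suc (count-u+count-d w))

take-suc : ∀ (w : List Step) k → k < length w → take (suc k) w ≡ take k w ++ [ letterAt w k ]
take-suc (x ∷ w) zero    _         = refl
take-suc (x ∷ w) (suc k) (s≤s k<n) = cong (x ∷_) (take-suc w k k<n)

count-take-suc : ∀ s w k → k < length w → count s (take (suc k) w) ≡ count s (take k w) + count s [ letterAt w k ]
count-take-suc s w k k<n = trans (cong (count s) (take-suc w k k<n)) (count-++ s (take k w) [ letterAt w k ])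

countFalse : (ℕ → Bool) → ℕ → ℕ
countFalse f zero    = 0
countFalse f (suc k) = countFalse f k + (if f k then 0 else 1)

countFalse-cong : ∀ f g k → (∀ j → j < k → f j ≡ g j) → countFalse f k ≡ countFalse g k
countFalse-cong f g zero    _   = refl
countFalse-cong f g (suc k) f≗g =
  cong₂ (λ c b → c + (if b then 0 else 1))
        (countFalse-cong f g k (λ j j<k → f≗g j (<-trans j<k (n<1+n k)))) (f≗g k (n<1+n k))

countFalse-pos : ∀ f k → 1 ≤ countFalse f k → ∃ λ j → j < k × f j ≡ false
countFalse-pos f (suc k) pos with f k in fk
... | false = k , n<1+n k , fk
... | true with countFalse-pos f k (subst (1 ≤_) (+-identityʳ (countFalse f k)) pos)
...   | j , j<k , fj = j , <-trans j<k (n<1+n k) , fj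

countFalse≡0 : ∀ f k → countFalse f k ≡ 0 → ∀ j → j < k → f j ≡ true
countFalse≡0 f (suc k) none j j<1+k with f k in fk | m≤n⇒m<n∨m≡n (≤-pred j<1+k)
... | true  | inj₂ refl = fk
... | true  | inj₁ j<k  = countFalse≡0 f k (trans (sym (+-identityʳ _)) none) j j<k
... | false | _         with () ← m+n≡0⇒n≡0 (countFalse f k) none

countFalse-flip : ∀ f g k j₀ → j₀ < k → (∀ j → j < k → j ≢ j₀ → f j ≡ g j) →
                  f j₀ ≡ false → g j₀ ≡ true → countFalse g k + 1 ≡ countFalse f k
countFalse-flip f g (suc k) j₀ j₀<1+k f≗g fj₀ gj₀ with m≤n⇒m<n∨m≡n (≤-pred j₀<1+k)
... | inj₂ refl rewrite fj₀ | gj₀ =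
  cong (_+ 1) (trans (+-identityʳ _)
    (countFalse-cong g f j₀ (λ j j<k → sym (f≗g j (<-trans j<k (n<1+n j₀)) (<⇒≢ j<k)))))
... | inj₁ j₀<k rewrite f≗g k (n<1+n k) (λ k≡j₀ → <-irrefl (sym k≡j₀) j₀<k) =
  trans (shuffle (countFalse g k) (if g k then 0 else 1))
        (cong (_+ (if g k then 0 else 1))
              (countFalse-flip f g k j₀ j₀<k (λ j j<k → f≗g j (<-trans j<k (n<1+n k))) fj₀ gj₀))
  where
  shuffle : ∀ a c → a + c + 1 ≡ a + 1 + c
  shuffle = solve-∀

[m%n+o]%n≡[m+o]%n : ∀ m o n .{{_ : NonZero n}} → (m % n + o) % n ≡ (m + o) % n
[m%n+o]%n≡[m+o]%n m o n = begin
  (m % n + o) % n          ≡⟨ %-distribˡ-+ (m % n) o n ⟩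
  (m % n % n + o % n) % n  ≡⟨ cong (λ t → (t + o % n) % n) (m%n%n≡m%n m n) ⟩
  (m % n + o % n) % n      ≡⟨ %-distribˡ-+ m o n ⟨
  (m + o) % n              ∎
  where open ≡-Reasoning

[[m+o]%n+[n∸o%n]]%n≡m : ∀ m o n .{{_ : NonZero n}} → m < n → ((m + o) % n + (n ∸ o % n)) % n ≡ m
[[m+o]%n+[n∸o%n]]%n≡m m o n m<n = begin
  ((m + o) % n + (n ∸ r)) % n  ≡⟨ [m%n+o]%n≡[m+o]%n (m + o) (n ∸ r) n ⟩
  ((m + o) + (n ∸ r)) % n      ≡⟨ cong (λ t → (m + t + (n ∸ r)) % n) (m≡m%n+[m/n]*n o n) ⟩
  (m + (r + q) + (n ∸ r)) % n  ≡⟨ cong (_% n) regroup ⟩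
  ((m + n) + q) % n            ≡⟨ [m+kn]%n≡m%n (m + n) (o / n) n ⟩
  (m + n) % n                  ≡⟨ [m+n]%n≡m%n m n ⟩
  m % n                        ≡⟨ m<n⇒m%n≡m m<n ⟩
  m                            ∎
  where
  open ≡-Reasoning
  r = o % n
  q = (o / n) * n
  regroup : m + (r + q) + (n ∸ r) ≡ (m + n) + q
  regroup = trans (shuffle m r q (n ∸ r)) (cong (λ t → m + t + q) (m+[n∸m]≡n (<⇒≤ (m%n<n o n))))
    where
    shuffle : ∀ m r q t → m + (r + q) + t ≡ m + (r + t) + q
    shuffle = solve-∀

[m+o]%n-injectiveˡ : ∀ {m m'} o n .{{_ : NonZero n}} → m < n → m' < n → (m + o) % n ≡ (m' + o) % n → m ≡ m'
[m+o]%n-injectiveˡ {m} {m'} o n m<n m'<n e = begin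
  m                                     ≡⟨ [[m+o]%n+[n∸o%n]]%n≡m m o n m<n ⟨
  ((m + o) % n + (n ∸ o % n)) % n       ≡⟨ cong (λ t → (t + (n ∸ o % n)) % n) e ⟩
  ((m' + o) % n + (n ∸ o % n)) % n      ≡⟨ [[m+o]%n+[n∸o%n]]%n≡m m' o n m'<n ⟩
  m'                                    ∎
  where open ≡-Reasoning

[m+[n∸o]]%n≡m∸o : ∀ m o n .{{_ : NonZero n}} → o ≤ m → m < n → (m + (n ∸ o)) % n ≡ m ∸ o
[m+[n∸o]]%n≡m∸o m o n o≤m m<n = begin
  (m + (n ∸ o)) % n        ≡⟨ cong (λ t → (t + (n ∸ o)) % n) (m∸n+n≡m o≤m) ⟨
  ((m ∸ o) + o + (n ∸ o)) % n ≡⟨ cong (_% n) (+-assoc (m ∸ o) o (n ∸ o)) ⟩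
  ((m ∸ o) + (o + (n ∸ o))) % n ≡⟨ cong (λ t → ((m ∸ o) + t) % n) (m+[n∸m]≡n (≤-trans o≤m (<⇒≤ m<n))) ⟩
  ((m ∸ o) + n) % n        ≡⟨ [m+n]%n≡m%n (m ∸ o) n ⟩
  (m ∸ o) % n              ≡⟨ m<n⇒m%n≡m (≤-<-trans (m∸n≤m m o) m<n) ⟩
  m ∸ o                    ∎
  where open ≡-Reasoning

∸-suc-< : ∀ {i k} → i < k → k ∸ suc i < k
∸-suc-< i<k = ∸-monoʳ-< (s≤s z≤n) i<k

∸-suc-involutive : ∀ {i k} → i < k → k ∸ suc (k ∸ suc i) ≡ i
∸-suc-involutive {k = suc k} (s≤s i≤k) = m∸[m∸n]≡n i≤k

∸-suc-cancel-< : ∀ k {i j} → k ∸ suc j < k ∸ suc i → i < j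
∸-suc-cancel-< k lt = ≰⇒> (λ j≤i → <⇒≱ lt (∸-monoʳ-≤ k (s≤s j≤i)))

m+m≡n+n⇒m≡n : ∀ {m n} → m + m ≡ n + n → m ≡ n
m+m≡n+n⇒m≡n {zero}  {zero}  _ = refl
m+m≡n+n⇒m≡n {suc m} {suc n} e =
  cong suc (m+m≡n+n⇒m≡n (suc-injective (trans (sym (+-suc m m)) (trans (suc-injective e) (+-suc n n)))))

module CCPGeometry {m' : ℕ} (σ : Permutation′ (suc m')) (σ-ccp : IsCCP σ) (1≤m' : 1 ≤ m') where

  M : ℕ
  M = suc m'

  appℕ-toℕ : ∀ (i : Fin M) → appℕ σ (toℕ i) ≡ toℕ (σ ⟨$⟩ʳ i)
  appℕ-toℕ i with toℕ i <? M
  ... | yes i<M = cong (λ t → toℕ (σ ⟨$⟩ʳ t)) (fromℕ<-toℕ i i<M)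
  ... | no  i≮M = ⊥-elim (i≮M (toℕ<n i))

  appℕ<M : ∀ j → appℕ σ j < M
  appℕ<M j with j <? M
  ... | yes _ = toℕ<n _
  ... | no  _ = s≤s z≤n

  appℕ-fromℕ< : ∀ {j} (j<M : j < M) → appℕ σ j ≡ toℕ (σ ⟨$⟩ʳ fromℕ< j<M)
  appℕ-fromℕ< j<M = trans (cong (appℕ σ) (sym (toℕ-fromℕ< j<M))) (appℕ-toℕ (fromℕ< j<M))

  appℕ-injective : ∀ {i j} → i < M → j < M → appℕ σ i ≡ appℕ σ j → i ≡ j
  appℕ-injective {i} {j} i<M j<M e = begin
    i                                     ≡⟨ toℕ-fromℕ< i<M ⟨
    toℕ (fromℕ< i<M)                      ≡⟨ cong toℕ (inverseˡ σ) ⟨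
    toℕ (σ ⟨$⟩ˡ (σ ⟨$⟩ʳ fromℕ< i<M))      ≡⟨ cong (λ t → toℕ (σ ⟨$⟩ˡ t)) σi≡σj ⟩
    toℕ (σ ⟨$⟩ˡ (σ ⟨$⟩ʳ fromℕ< j<M))      ≡⟨ cong toℕ (inverseˡ σ) ⟩
    toℕ (fromℕ< j<M)                      ≡⟨ toℕ-fromℕ< j<M ⟩
    j                                     ∎
    where
    open ≡-Reasoning
    σi≡σj : σ ⟨$⟩ʳ fromℕ< i<M ≡ σ ⟨$⟩ʳ fromℕ< j<M
    σi≡σj = toℕ-injective (trans (sym (appℕ-fromℕ< i<M)) (trans e (appℕ-fromℕ< j<M)))

  appℕ-surjective : ∀ {y} → y < M → ∃ λ j → j < M × appℕ σ j ≡ y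
  appℕ-surjective y<M = toℕ i , toℕ<n i , trans (appℕ-toℕ i) (trans (cong toℕ (inverseʳ σ)) (toℕ-fromℕ< y<M))
    where i = σ ⟨$⟩ˡ fromℕ< y<M

  InPrefixℕ : ℕ → ℕ → Set
  InPrefixℕ k y = ∃ λ j → j < k × appℕ σ j ≡ y

  InPrefixℕ-mono : ∀ {k k' y} → k ≤ k' → InPrefixℕ k y → InPrefixℕ k' y
  InPrefixℕ-mono k≤k' (j , j<k , σj≡y) = j , <-≤-trans j<k k≤k' , σj≡y

  InPrefixℕ⇒<M : ∀ {k y} → InPrefixℕ k y → y < M
  InPrefixℕ⇒<M (j , _ , σj≡y) = subst (_< M) σj≡y (appℕ<M j)

  appℕ∉InPrefixℕ : ∀ {k} → k < M → ¬ InPrefixℕ k (appℕ σ k)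
  appℕ∉InPrefixℕ k<M (j , j<k , σj≡σk) = <-irrefl (appℕ-injective (<-trans j<k k<M) k<M σj≡σk) j<k

  InBlockℕ : ℕ → ℕ → ℕ → Set
  InBlockℕ x k y = ∃ λ j → j < k × y ≡ (x + j) % M

  record PrefixBlock (k : ℕ) : Set where
    field
      first        : ℕ
      first<M      : first < M
      prefix⇒block : ∀ {y} → InPrefixℕ k y → InBlockℕ first k y
      block⇒prefix : ∀ {y} → y < M → InBlockℕ first k y → InPrefixℕ k y

  prefix-block : ∀ k → 1 ≤ k → k ≤ M → PrefixBlock k
  prefix-block k 1≤k k≤M with σ-ccp k 1≤k k≤M
  ... | x , prefix⇔block = record
    { first = toℕ x ; first<M = toℕ<n x ; prefix⇒block = to ; block⇒prefix = from }
    where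
    to : ∀ {y} → InPrefixℕ k y → InBlockℕ (toℕ x) k y
    to {y} y∈@(j , j<k , σj≡y) with Equivalence.to (prefix⇔block (fromℕ< y<M))
        (fromℕ< j<M , subst (_< k) (sym (toℕ-fromℕ< j<M)) j<k ,
         toℕ-injective (trans (sym (appℕ-fromℕ< j<M)) (trans σj≡y (sym (toℕ-fromℕ< y<M)))))
      where
      y<M : y < M
      y<M = InPrefixℕ⇒<M y∈
      j<M : j < M
      j<M = <-≤-trans j<k k≤M
    ... | i , i<k , y≡x+i = i , i<k , trans (sym (toℕ-fromℕ< (InPrefixℕ⇒<M y∈))) y≡x+i
    from : ∀ {y} → y < M → InBlockℕ (toℕ x) k y → InPrefixℕ k y
    from y<M (j , j<k , y≡x+j) with Equivalence.from (prefix⇔block (fromℕ< y<M)) (j , j<k , trans (toℕ-fromℕ< y<M) y≡x+j)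
    ... | i , i<k , σi≡y = toℕ i , i<k , trans (appℕ-toℕ i) (trans (cong toℕ σi≡y) (toℕ-fromℕ< y<M))

  module Last = PrefixBlock (prefix-block m' 1≤m' (n≤1+n m'))

  -- Rotating by rot makes σ(0), …, σ(m'-1) the points 1, …, m', so every
  -- prefix block becomes an honest interval inside 1, …, m' (nothing wraps).
  rot : ℕ → ℕ
  rot y = (y + suc (M ∸ Last.first)) % M

  rot<M : ∀ y → rot y < M
  rot<M y = m%n<n (y + suc (M ∸ Last.first)) M

  rot-+ : ∀ a j → rot ((a + j) % M) ≡ (rot a + j) % M
  rot-+ a j = begin
    ((a + j) % M + e) % M  ≡⟨ [m%n+o]%n≡[m+o]%n (a + j) e M ⟩
    (a + j + e) % M        ≡⟨ cong (_% M) (swap a j e) ⟩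
    (a + e + j) % M        ≡⟨ [m%n+o]%n≡[m+o]%n (a + e) j M ⟨
    (rot a + j) % M        ∎
    where
    open ≡-Reasoning
    e = suc (M ∸ Last.first)
    swap : ∀ a j e → a + j + e ≡ a + e + j
    swap = solve-∀

  rot-suc : ∀ y → rot (suc y % M) ≡ suc (rot y) % M
  rot-suc y = trans (cong (λ t → rot (t % M)) (+-comm 1 y)) (trans (rot-+ y 1) (cong (_% M) (+-comm (rot y) 1)))

  rot-injective : ∀ {y y'} → y < M → y' < M → rot y ≡ rot y' → y ≡ y'
  rot-injective = [m+o]%n-injectiveˡ (suc (M ∸ Last.first)) M

  rot-first : rot Last.first ≡ 1
  rot-first = begin
    (x + suc (M ∸ x)) % M  ≡⟨ cong (_% M) (+-suc x (M ∸ x)) ⟩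
    suc (x + (M ∸ x)) % M  ≡⟨ cong (λ t → suc t % M) (m+[n∸m]≡n (<⇒≤ Last.first<M)) ⟩
    (1 + M) % M            ≡⟨ [m+n]%n≡m%n 1 M ⟩
    1 % M                  ≡⟨ m<n⇒m%n≡m (s≤s 1≤m') ⟩
    1                      ∎
    where
    open ≡-Reasoning
    x = Last.first

  rot-first+ : ∀ j → rot ((Last.first + j) % M) ≡ (1 + j) % M
  rot-first+ j = trans (rot-+ Last.first j) (cong (λ t → (t + j) % M) rot-first)

  rot-surjective : ∀ {c} → c < M → ∃ λ y → y < M × rot y ≡ c
  rot-surjective {c} c<M = (Last.first + (c + m')) % M , m%n<n (Last.first + (c + m')) M , (begin
    rot ((Last.first + (c + m')) % M)  ≡⟨ rot-first+ (c + m') ⟩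
    suc (c + m') % M                   ≡⟨ cong (_% M) (+-suc c m') ⟨
    (c + M) % M                        ≡⟨ [m+n]%n≡m%n c M ⟩
    c % M                              ≡⟨ m<n⇒m%n≡m c<M ⟩
    c                                  ∎)
    where open ≡-Reasoning

  1≤rot : ∀ {y} → InPrefixℕ m' y → 1 ≤ rot y
  1≤rot {y} y∈ with Last.prefix⇒block y∈
  ... | j , j<m' , y≡ = subst (1 ≤_) (sym rot-y) (s≤s z≤n)
    where
    rot-y : rot y ≡ suc j
    rot-y = trans (cong rot y≡) (trans (rot-first+ j) (m<n⇒m%n≡m (s≤s j<m')))

  in-block : ∀ {A k y} j → j < k → y < M → (rot A + j) % M ≡ rot y → InBlockℕ A k y
  in-block {A} {k} {y} j j<k y<M e = j , j<k , rot-injective y<M (m%n<n (A + j) M) (trans (sym e) (sym (rot-+ A j)))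

  unwrapped-block : ∀ {A k' y} → rot A + k' < M → InBlockℕ A (suc k') y → rot A ≤ rot y × rot y ≤ rot A + k'
  unwrapped-block {A} {k'} {y} no-wrap (j , s≤s j≤k' , y≡) =
    subst (rot A ≤_) (sym rot-y) (m≤m+n (rot A) j) , subst (_≤ rot A + k') (sym rot-y) (+-monoʳ-≤ (rot A) j≤k')
    where
    rot-y : rot y ≡ rot A + j
    rot-y = trans (cong rot y≡) (trans (rot-+ A j) (m<n⇒m%n≡m (≤-<-trans (+-monoʳ-≤ (rot A) j≤k') no-wrap)))

  unwrapped-block-complete : ∀ {A k' y} → y < M → rot A ≤ rot y → rot y ≤ rot A + k' → InBlockℕ A (suc k') y
  unwrapped-block-complete {A} {k'} {y} y<M lo hi =
    in-block {A} j (s≤s (+-cancelˡ-≤ (rot A) j k' (subst (_≤ rot A + k') (sym A+j≡y) hi)))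
             y<M (trans (cong (_% M) A+j≡y) (m<n⇒m%n≡m (rot<M y)))
    where
    j = rot y ∸ rot A
    A+j≡y : rot A + j ≡ rot y
    A+j≡y = m+[n∸m]≡n lo

  %-wrap : ∀ {t} → M ≤ t → t < M + M → t % M ≡ t ∸ M
  %-wrap {t} M≤t t<2M = trans (sym (m≤n⇒[n∸m]%m≡n%m M≤t))
                               (m<n⇒m%n≡m (subst (t ∸ M <_) (m+n∸n≡m M M) (∸-monoˡ-< t<2M M≤t)))

  wrapped-block : ∀ {A k' y} → M ≤ rot A + k' → suc k' ≤ M → InBlockℕ A (suc k') y →
                  rot A ≤ rot y ⊎ rot y ≤ rot A + k' ∸ M
  wrapped-block {A} {k'} {y} wrap k≤M (j , s≤s j≤k' , y≡) with rot A + j <? M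
  ... | yes A+j<M = inj₁ (subst (rot A ≤_) (sym (trans rot-y (m<n⇒m%n≡m A+j<M))) (m≤m+n (rot A) j))
    where rot-y = trans (cong rot y≡) (rot-+ A j)
  ... | no  A+j≮M = inj₂ (subst (_≤ rot A + k' ∸ M) (sym (trans rot-y (%-wrap (≮⇒≥ A+j≮M) A+j<2M)))
                              (∸-monoˡ-≤ M (+-monoʳ-≤ (rot A) j≤k')))
    where
    rot-y = trans (cong rot y≡) (rot-+ A j)
    A+j<2M : rot A + j < M + M
    A+j<2M = +-mono-< (rot<M A) (<-≤-trans (s≤s j≤k') k≤M)

  wrapped-block-complete : ∀ {A k' y} → M ≤ rot A + k' → y < M → rot A ≤ rot y ⊎ rot y ≤ rot A + k' ∸ M →
                           InBlockℕ A (suc k') y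
  wrapped-block-complete {A} {k'} {y} wrap y<M (inj₁ lo) =
    in-block {A} j (s≤s (+-cancelˡ-≤ (rot A) j k' (subst (_≤ rot A + k') (sym A+j≡y) (≤-trans (<⇒≤ (rot<M y)) wrap))))
             y<M (trans (cong (_% M) A+j≡y) (m<n⇒m%n≡m (rot<M y)))
    where
    j = rot y ∸ rot A
    A+j≡y : rot A + j ≡ rot y
    A+j≡y = m+[n∸m]≡n lo
  wrapped-block-complete {A} {k'} {y} wrap y<M (inj₂ hi) =
    in-block {A} j (s≤s (+-cancelˡ-≤ (rot A) j k' (subst (_≤ rot A + k') (sym A+j≡y+M) y+M≤A+k')))
             y<M (trans (cong (_% M) A+j≡y+M) (trans ([m+n]%n≡m%n (rot y) M) (m<n⇒m%n≡m (rot<M y))))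
    where
    j = rot y + M ∸ rot A
    A+j≡y+M : rot A + j ≡ rot y + M
    A+j≡y+M = m+[n∸m]≡n (≤-trans (<⇒≤ (rot<M A)) (m≤n+m M (rot y)))
    y+M≤A+k' : rot y + M ≤ rot A + k'
    y+M≤A+k' = subst (rot y + M ≤_) (m∸n+n≡m wrap) (+-monoˡ-≤ M hi)

  record PrefixInterval (k l : ℕ) : Set where
    field
      1≤l      : 1 ≤ l
      l+k≤M    : l + k ≤ M
      bounds   : ∀ {y} → InPrefixℕ k y → l ≤ rot y × rot y < l + k
      complete : ∀ {y} → y < M → l ≤ rot y → rot y < l + k → InPrefixℕ k y

  prefix-interval : ∀ k → 1 ≤ k → k ≤ m' → ∃ (PrefixInterval k)
  prefix-interval (suc k₀) 1≤k k≤m' = rot x , record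
    { 1≤l      = subst (1 ≤_) (cong rot x+0≡x) (1≤rot-block 0 1≤k)
    ; l+k≤M    = subst (_≤ M) (sym (+-suc (rot x) k₀)) (no-wrap k₀ ≤-refl)
    ; bounds   = bounds
    ; complete = λ {y} y<M lo hi → block⇒prefix y<M
                   (unwrapped-block-complete {x} {k₀} y<M lo (≤-pred (subst (rot y <_) (+-suc (rot x) k₀) hi))) }
    where
    open PrefixBlock (prefix-block (suc k₀) 1≤k (≤-trans k≤m' (n≤1+n m'))) renaming (first to x; first<M to x<M)
    x+0≡x : (x + 0) % M ≡ x
    x+0≡x = trans (cong (_% M) (+-identityʳ x)) (m<n⇒m%n≡m x<M)
    1≤rot-block : ∀ j → j < suc k₀ → 1 ≤ rot ((x + j) % M)
    1≤rot-block j j<k = 1≤rot (InPrefixℕ-mono k≤m' (block⇒prefix (m%n<n (x + j) M) (j , j<k , refl)))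
    -- walking along the block, rot never passes through 0, so it never wraps
    no-wrap : ∀ j → j < suc k₀ → rot x + j < M
    no-wrap zero    _     = subst (_< M) (sym (+-identityʳ (rot x))) (rot<M x)
    no-wrap (suc j) 1+j<k with m≤n⇒m<n∨m≡n (subst (_≤ M) (sym (+-suc (rot x) j)) (no-wrap j (<-trans (n<1+n j) 1+j<k)))
    ... | inj₁ lt = lt
    ... | inj₂ eq = ⊥-elim (<-irrefl (sym (trans (rot-+ x (suc j)) (trans (cong (_% M) eq) (n%n≡0 M))))
                                      (1≤rot-block (suc j) 1+j<k))
    bounds : ∀ {y} → InPrefixℕ (suc k₀) y → rot x ≤ rot y × rot y < rot x + suc k₀
    bounds {y} y∈ with unwrapped-block {x} {k₀} (no-wrap k₀ ≤-refl) (prefix⇒block y∈)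
    ... | lo , hi = lo , subst (rot y <_) (sym (+-suc (rot x) k₀)) (s≤s hi)

  adjacent-of-last : ∀ {l} → PrefixInterval m' l → suc (rot (appℕ σ m')) ≡ l ⊎ rot (appℕ σ m') ≡ l + m'
  adjacent-of-last {l} I = inj₁ (trans (cong suc rot-s≡0) (sym l≡1))
    where
    open PrefixInterval I
    s = appℕ σ m'
    l≡1 : l ≡ 1
    l≡1 = ≤-antisym (+-cancelʳ-≤ m' l 1 l+k≤M) 1≤l
    rot-s≡0 : rot s ≡ 0
    rot-s≡0 with rot s ≟ 0
    ... | yes eq = eq
    ... | no  ne = ⊥-elim (appℕ∉InPrefixℕ (n<1+n m')
                     (complete (appℕ<M m') (subst (_≤ rot s) (sym l≡1) (n≢0⇒n>0 ne))
                                           (subst (rot s <_) (cong (_+ m') (sym l≡1)) (rot<M s))))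

  adjacent-of-nested : ∀ {k l l'} → 1 ≤ k → k < M → PrefixInterval k l → PrefixInterval (suc k) l' →
                       suc (rot (appℕ σ k)) ≡ l ⊎ rot (appℕ σ k) ≡ l + k
  adjacent-of-nested {suc k₀} {l} {l'} _ k<M I I' = classify (l ≤? rot s) (l + k ≤? rot s)
    where
    open PrefixInterval I
    module I' = PrefixInterval I'
    k = suc k₀
    s = appℕ σ k
    s-bounds : l' ≤ rot s × rot s < l' + suc k
    s-bounds = I'.bounds (k , n<1+n k , refl)
    end-bounds : ∀ {c} → l ≤ c → c < l + k → l' ≤ c × c < l' + suc k
    end-bounds {c} l≤c c<l+k with rot-surjective (<-≤-trans c<l+k l+k≤M)
    ... | y , y<M , rot-y≡c = subst (λ t → l' ≤ t × t < l' + suc k) rot-y≡c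
                                (I'.bounds (InPrefixℕ-mono (n≤1+n k) (complete y<M (subst (l ≤_) (sym rot-y≡c) l≤c)
                                                                                     (subst (_< l + k) (sym rot-y≡c) c<l+k))))
    l'≤l : l' ≤ l
    l'≤l = proj₁ (end-bounds ≤-refl (m<m+n l (s≤s z≤n)))
    l≤1+l' : l ≤ suc l'
    l≤1+l' = ≤-pred (+-cancelʳ-< k₀ l (suc (suc l'))
               (subst₂ _<_ refl (trans (+-suc l' (suc k₀)) (cong suc (+-suc l' k₀)))
                 (proj₂ (end-bounds (m≤m+n l k₀) (+-monoʳ-< l (n<1+n k₀))))))
    s<l+1+k : rot s < l + suc k
    s<l+1+k = <-≤-trans (proj₂ s-bounds) (+-monoˡ-≤ (suc k) l'≤l)
    classify : Dec (l ≤ rot s) → Dec (l + k ≤ rot s) → suc (rot s) ≡ l ⊎ rot s ≡ l + k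
    classify (no  l≰s) _           = inj₁ (≤-antisym (≰⇒> l≰s) (≤-trans l≤1+l' (s≤s (proj₁ s-bounds))))
    classify (yes l≤s) (no l+k≰s)  = ⊥-elim (appℕ∉InPrefixℕ k<M (complete (appℕ<M k) l≤s (≰⇒> l+k≰s)))
    classify (yes _)   (yes l+k≤s) = inj₂ (≤-antisym (≤-pred (subst (rot s <_) (+-suc l k) s<l+1+k)) l+k≤s)

  adjacent-endpoint : ∀ {k l} → 1 ≤ k → k ≤ m' → PrefixInterval k l →
                      suc (rot (appℕ σ k)) ≡ l ⊎ rot (appℕ σ k) ≡ l + k
  adjacent-endpoint {k} 1≤k k≤m' I with m≤n⇒m<n∨m≡n k≤m'
  ... | inj₁ k<m' = adjacent-of-nested 1≤k (<-trans k<m' (n<1+n m')) I (proj₂ (prefix-interval (suc k) (s≤s z≤n) k<m'))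
  ... | inj₂ refl = adjacent-of-last I

  adjacentUp : ℕ → Bool
  adjacentUp k = any (λ y → y ≡ᵇ suc (appℕ σ k) % M) (map (appℕ σ) (upTo k))

  upRoute downRoute : ℕ → ℕ → ℕ
  upRoute   k j = (suc (appℕ σ k) + j) % M
  downRoute k j = (appℕ σ k + (M ∸ suc j)) % M

  invStep-up : ∀ ps k {v} → adjacentUp k ≡ true → firstUnpaired ps (applyUpTo (upRoute k) k) ≡ just v →
               invStep σ ps k ≡ (appℕ σ k , v) ∷ ps
  invStep-up ps k up found rewrite up | map-upTo (upRoute k) k | found = refl

  invStep-down : ∀ ps k {v} → adjacentUp k ≡ false → firstUnpaired ps (applyUpTo (downRoute k) k) ≡ just v →
                 invStep σ ps k ≡ (appℕ σ k , v) ∷ ps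
  invStep-down ps k down found rewrite down | map-upTo (downRoute k) k | found = refl

  upward : ∀ {k l} → 1 ≤ k → PrefixInterval k l → suc (rot (appℕ σ k)) ≡ l →
           adjacentUp k ≡ true × (∀ j → j < k → rot (upRoute k j) ≡ l + j)
  upward {k} {l} 1≤k I 1+s≡l = up , route
    where
    open PrefixInterval I
    s = appℕ σ k
    rot-next : rot (suc s % M) ≡ l
    rot-next = trans (rot-suc s) (trans (cong (_% M) 1+s≡l) (m<n⇒m%n≡m (<-≤-trans (m<m+n l 1≤k) l+k≤M)))
    up : adjacentUp k ≡ true
    up with complete (m%n<n (suc s) M) (subst (l ≤_) (sym rot-next) ≤-refl) (subst (_< l + k) (sym rot-next) (m<m+n l 1≤k))
    ... | j , j<k , σj≡ = trans (cong (any _) (map-upTo (appℕ σ) k)) (any-applyUpTo-true (appℕ σ) _ k j j<k σj≡)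
    route : ∀ j → j < k → rot (upRoute k j) ≡ l + j
    route j j<k = begin
      rot ((suc s + j) % M)  ≡⟨ cong (λ t → rot (t % M)) (+-suc s j) ⟨
      rot ((s + suc j) % M)  ≡⟨ rot-+ s (suc j) ⟩
      (rot s + suc j) % M    ≡⟨ cong (_% M) (trans (+-suc (rot s) j) (cong (_+ j) 1+s≡l)) ⟩
      (l + j) % M            ≡⟨ m<n⇒m%n≡m (<-≤-trans (+-monoʳ-< l j<k) l+k≤M) ⟩
      l + j                  ∎
      where open ≡-Reasoning

  downward : ∀ {k l} → PrefixInterval k l → rot (appℕ σ k) ≡ l + k →
             adjacentUp k ≡ false × (∀ j → j < k → rot (downRoute k j) ≡ l + (k ∸ suc j))
  downward {k} {l} I s≡l+k = down , route
    where
    open PrefixInterval I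
    s = appℕ σ k
    l+k<M : l + k < M
    l+k<M = subst (_< M) s≡l+k (rot<M s)
    rot-next : rot (suc s % M) ≡ suc (l + k) % M
    rot-next = trans (rot-suc s) (cong (λ t → suc t % M) s≡l+k)
    -- rot (s + 1) is l + k + 1, or 0 if that wraps; either way it lies outside [l, l + k)
    next∉ : ∀ j → j < k → appℕ σ j ≢ suc s % M
    next∉ j j<k σj≡ with bounds (j , j<k , σj≡) | m≤n⇒m<n∨m≡n l+k<M
    ... | _  , hi | inj₁ l+k+1<M = <-asym hi (subst (l + k <_) (sym (trans rot-next (m<n⇒m%n≡m l+k+1<M))) ≤-refl)
    ... | lo , _  | inj₂ l+k+1≡M =
      <-irrefl refl (<-≤-trans 1≤l (subst (l ≤_) (trans rot-next (trans (cong (_% M) l+k+1≡M) (n%n≡0 M))) lo))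
    down : adjacentUp k ≡ false
    down = trans (cong (any _) (map-upTo (appℕ σ) k)) (any-applyUpTo-false (appℕ σ) _ k next∉)
    route : ∀ j → j < k → rot (downRoute k j) ≡ l + (k ∸ suc j)
    route j j<k = begin
      rot ((s + (M ∸ suc j)) % M)  ≡⟨ rot-+ s (M ∸ suc j) ⟩
      (rot s + (M ∸ suc j)) % M    ≡⟨ [m+[n∸o]]%n≡m∸o (rot s) (suc j) M 1+j≤s (rot<M s) ⟩
      rot s ∸ suc j                ≡⟨ cong (_∸ suc j) s≡l+k ⟩
      l + k ∸ suc j                ≡⟨ +-∸-assoc l j<k ⟩
      l + (k ∸ suc j)              ∎
      where
      open ≡-Reasoning
      1+j≤s : suc j ≤ rot s
      1+j≤s = subst (suc j ≤_) (sym s≡l+k) (≤-trans j<k (m≤n+m k l))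

  route-hits : ∀ {k l} (f : ℕ → ℕ) → (∀ j → f j < M) → (∀ j → j < k → rot (f j) ≡ l + j) →
               ∀ {y} → y < M → l ≤ rot y → rot y < l + k → ∃ λ i → i < k × f i ≡ y × rot y ≡ l + i
  route-hits {k} {l} f f<M route {y} y<M l≤y y<l+k = i , i<k , rot-injective (f<M i) y<M (trans (route i i<k) l+i≡y) , sym l+i≡y
    where
    i = rot y ∸ l
    l+i≡y : l + i ≡ rot y
    l+i≡y = m+[n∸m]≡n l≤y
    i<k : i < k
    i<k = +-cancelˡ-< l i k (subst (_< l + k) (sym l+i≡y) y<l+k)

module InverseAlgorithmInvariant {m' : ℕ} (σ : Permutation′ (suc m')) (σ-ccp : IsCCP σ) (1≤m' : 1 ≤ m')
                                 (P : List Step) where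

  open CCPGeometry σ σ-ccp 1≤m'

  #u #d : ℕ → ℕ
  #u k = count u (take k P)
  #d k = count d (take k P)

  #unpaired : Pairs → ℕ → ℕ
  #unpaired ps = countFalse (λ j → isPaired ps (appℕ σ j))

  record Invariant (k : ℕ) (ps : Pairs) : Set where
    field
      symmetric   : ∀ {a b} → partnerOf ps a ≡ just b → partnerOf ps b ≡ just a
      irreflexive : ∀ {a b} → partnerOf ps a ≡ just b → a ≢ b
      within      : ∀ {a b} → partnerOf ps a ≡ just b → InPrefixℕ k a
      nested      : ∀ {a b y} → partnerOf ps a ≡ just b → rot a < rot y → rot y < rot b → y < M →
                    ∃ λ z → partnerOf ps y ≡ just z × rot a < rot z × rot z < rot b
      balance     : #unpaired ps k + #d k ≡ #u k

  open Invariant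

  invariant-start : Invariant 0 []
  invariant-start = record
    { symmetric = λ () ; irreflexive = λ () ; within = λ () ; nested = λ () ; balance = refl }

  unpaired-outside : ∀ {k ps x} → Invariant k ps → ¬ InPrefixℕ k x → partnerOf ps x ≡ nothing
  unpaired-outside {ps = ps} {x} I x∉ with partnerOf ps x in e
  ... | nothing = refl
  ... | just _  = ⊥-elim (x∉ (within I e))

  invariant-up : ∀ {k ps} → Invariant k ps → k < M → k < length P → letterAt P k ≡ u → Invariant (suc k) ps
  invariant-up {k} {ps} I k<M k<len letter-u = record
    { symmetric = symmetric I ; irreflexive = irreflexive I ; nested = nested I
    ; within = InPrefixℕ-mono (n≤1+n k) ∘ within I ; balance = balance' }
    where
    fresh : isPaired ps (appℕ σ k) ≡ false
    fresh = partnerOf≡nothing⇒unpaired ps _ (unpaired-outside I (appℕ∉InPrefixℕ k<M))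
    balance' : #unpaired ps (suc k) + #d (suc k) ≡ #u (suc k)
    balance' rewrite fresh | count-take-suc d P k k<len | count-take-suc u P k k<len | letter-u =
      trans (shuffle (#unpaired ps k) (#d k)) (cong (_+ 1) (balance I))
      where
      shuffle : ∀ a b → a + 1 + (b + 0) ≡ a + b + 1
      shuffle = solve-∀

  module Extend {k ps} (I : Invariant k ps) (k<M : k < M) (k<len : k < length P) (letter-d : letterAt P k ≡ d)
                {v} (v∈ : InPrefixℕ k v) (v-free : partnerOf ps v ≡ nothing) where

    s : ℕ
    s = appℕ σ k

    ps' : Pairs
    ps' = (s , v) ∷ ps

    s≢v : s ≢ v
    s≢v s≡v = appℕ∉InPrefixℕ k<M (subst (InPrefixℕ k) (sym s≡v) v∈)

    paired≢s : ∀ {x z} → partnerOf ps x ≡ just z → s ≢ x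
    paired≢s e refl = appℕ∉InPrefixℕ k<M (within I e)

    paired≢v : ∀ {x z} → partnerOf ps x ≡ just z → v ≢ x
    paired≢v e refl = nothing≢just (trans (sym v-free) e)

    partner-within : ∀ {y z} → partnerOf ps y ≡ just z → InPrefixℕ k z
    partner-within e = within I (symmetric I e)

    old-arc : ∀ {y z} → partnerOf ps y ≡ just z → partnerOf ps' y ≡ just z
    old-arc e = trans (partnerOf-other ps (paired≢s e) (paired≢v e)) e

    ps'-inv : ∀ {x z} → partnerOf ps' x ≡ just z → (x ≡ s × z ≡ v) ⊎ (x ≡ v × z ≡ s) ⊎ partnerOf ps x ≡ just z
    ps'-inv {x} {z} = partnerOf-∷-inv {s} {v} {x} {z} ps

    symmetric' : ∀ {a b} → partnerOf ps' a ≡ just b → partnerOf ps' b ≡ just a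
    symmetric' e with ps'-inv e
    ... | inj₁ (refl , refl)        = partnerOf-snd ps s≢v
    ... | inj₂ (inj₁ (refl , refl)) = partnerOf-fst s v ps
    ... | inj₂ (inj₂ e')            = old-arc (symmetric I e')

    irreflexive' : ∀ {a b} → partnerOf ps' a ≡ just b → a ≢ b
    irreflexive' e with ps'-inv e
    ... | inj₁ (refl , refl)        = s≢v
    ... | inj₂ (inj₁ (refl , refl)) = s≢v ∘ sym
    ... | inj₂ (inj₂ e')            = irreflexive I e'

    within' : ∀ {a b} → partnerOf ps' a ≡ just b → InPrefixℕ (suc k) a
    within' e with ps'-inv e
    ... | inj₁ (refl , refl)        = k , n<1+n k , refl
    ... | inj₂ (inj₁ (refl , refl)) = InPrefixℕ-mono (n≤1+n k) v∈
    ... | inj₂ (inj₂ e')            = InPrefixℕ-mono (n≤1+n k) (within I e')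

    -- s becomes paired and v stops being unpaired, while a d is read
    balance' : #unpaired ps' (suc k) + #d (suc k) ≡ #u (suc k)
    balance' rewrite partnerOf≡just⇒paired ps' s (partnerOf-fst s v ps)
                   | count-take-suc d P k k<len | count-take-suc u P k k<len | letter-d = begin
      #unpaired ps' k + 0 + (#d k + 1)  ≡⟨ shuffle (#unpaired ps' k) (#d k) ⟩
      #unpaired ps' k + 1 + #d k        ≡⟨ cong (_+ #d k) v-flips ⟩
      #unpaired ps k + #d k             ≡⟨ balance I ⟩
      #u k                              ≡⟨ +-identityʳ (#u k) ⟨
      #u k + 0                          ∎
      where
      open ≡-Reasoning
      shuffle : ∀ a b → a + 0 + (b + 1) ≡ a + 1 + b
      shuffle = solve-∀
      j₀ : ℕ
      j₀ = proj₁ v∈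
      j₀<k : j₀ < k
      j₀<k = proj₁ (proj₂ v∈)
      σj₀≡v : appℕ σ j₀ ≡ v
      σj₀≡v = proj₂ (proj₂ v∈)
      unchanged : ∀ j → j < k → j ≢ j₀ → isPaired ps (appℕ σ j) ≡ isPaired ps' (appℕ σ j)
      unchanged j j<k j≢j₀ = isPaired-cong ps ps' (appℕ σ j) (sym (partnerOf-other ps s≢σj v≢σj))
        where
        s≢σj : s ≢ appℕ σ j
        s≢σj e = <-irrefl (appℕ-injective (<-trans j<k k<M) k<M (sym e)) j<k
        v≢σj : v ≢ appℕ σ j
        v≢σj e = j≢j₀ (appℕ-injective (<-trans j<k k<M) (<-trans j₀<k k<M) (trans (sym e) (sym σj₀≡v)))
      v-flips : #unpaired ps' k + 1 ≡ #unpaired ps k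
      v-flips = countFalse-flip _ _ k j₀ j₀<k unchanged
                  (trans (cong (isPaired ps) σj₀≡v) (partnerOf≡nothing⇒unpaired ps v v-free))
                  (trans (cong (isPaired ps') σj₀≡v) (partnerOf≡just⇒paired ps' v (partnerOf-snd ps s≢v)))

    v-unpaired : ∀ {w} → partnerOf ps v ≢ just w
    v-unpaired e = nothing≢just (trans (sym v-free) e)

    partner≢v : ∀ {y z} → partnerOf ps y ≡ just z → rot z ≢ rot v
    partner≢v e z≡v = paired≢v (symmetric I e)
      (sym (rot-injective (InPrefixℕ⇒<M (partner-within e)) (InPrefixℕ⇒<M v∈) z≡v))

    partner-below-v : ∀ {y z} → partnerOf ps y ≡ just z → rot y < rot v → rot z < rot v
    partner-below-v {y} {z} e y<v with <-cmp (rot z) (rot v)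
    ... | tri< z<v _ _ = z<v
    ... | tri≈ _ z≡v _ = ⊥-elim (partner≢v e z≡v)
    ... | tri> _ _ v<z = ⊥-elim (v-unpaired (proj₁ (proj₂ (nested I e y<v v<z (InPrefixℕ⇒<M v∈)))))

    partner-above-v : ∀ {y z} → partnerOf ps y ≡ just z → rot v < rot y → rot v < rot z
    partner-above-v {y} {z} e v<y with <-cmp (rot z) (rot v)
    ... | tri> _ _ v<z = v<z
    ... | tri≈ _ z≡v _ = ⊥-elim (partner≢v e z≡v)
    ... | tri< z<v _ _ = ⊥-elim (v-unpaired (proj₁ (proj₂ (nested I (symmetric I e) z<v v<y (InPrefixℕ⇒<M v∈)))))

    nested-old : ∀ {a b y} → partnerOf ps a ≡ just b → rot a < rot y → rot y < rot b → y < M →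
                 ∃ λ z → partnerOf ps' y ≡ just z × rot a < rot z × rot z < rot b
    nested-old e a<y y<b y<M with nested I e a<y y<b y<M
    ... | z , ez , a<z , z<b = z , old-arc ez , a<z , z<b

    extend-up : rot s < rot v →
                (∀ {y} → y < M → rot s < rot y → rot y < rot v → ∃ λ z → partnerOf ps y ≡ just z) →
                (∀ {z} → InPrefixℕ k z → rot s < rot z) → Invariant (suc k) ps'
    extend-up s<v between-paired s-below = record
      { symmetric = symmetric' ; irreflexive = irreflexive' ; within = within' ; nested = nested' ; balance = balance' }
      where
      nested' : ∀ {a b y} → partnerOf ps' a ≡ just b → rot a < rot y → rot y < rot b → y < M →
                ∃ λ z → partnerOf ps' y ≡ just z × rot a < rot z × rot z < rot b
      nested' e a<y y<b y<M with ps'-inv e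
      ... | inj₂ (inj₂ e')            = nested-old e' a<y y<b y<M
      ... | inj₂ (inj₁ (refl , refl)) = ⊥-elim (<-asym s<v (<-trans a<y y<b))
      ... | inj₁ (refl , refl) with between-paired y<M a<y y<b
      ...   | z , ez = z , old-arc ez , s-below (partner-within ez) , partner-below-v ez y<b

    extend-down : rot v < rot s →
                  (∀ {y} → y < M → rot v < rot y → rot y < rot s → ∃ λ z → partnerOf ps y ≡ just z) →
                  (∀ {z} → InPrefixℕ k z → rot z < rot s) → Invariant (suc k) ps'
    extend-down v<s between-paired s-above = record
      { symmetric = symmetric' ; irreflexive = irreflexive' ; within = within' ; nested = nested' ; balance = balance' }
      where
      nested' : ∀ {a b y} → partnerOf ps' a ≡ just b → rot a < rot y → rot y < rot b → y < M →
                ∃ λ z → partnerOf ps' y ≡ just z × rot a < rot z × rot z < rot b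
      nested' e a<y y<b y<M with ps'-inv e
      ... | inj₂ (inj₂ e')            = nested-old e' a<y y<b y<M
      ... | inj₁ (refl , refl)        = ⊥-elim (<-asym v<s (<-trans a<y y<b))
      ... | inj₂ (inj₁ (refl , refl)) with between-paired y<M a<y y<b
      ...   | z , ez = z , old-arc ez , partner-above-v ez a<y , s-above (partner-within ez)

  some-unpaired : ∀ {k ps} → Invariant k ps → k < length P → letterAt P k ≡ d → #d (suc k) ≤ #u (suc k) →
                  ∃ λ j → j < k × isPaired ps (appℕ σ j) ≡ false
  some-unpaired {k} {ps} I k<len letter-d dyck =
    countFalse-pos _ k (+-cancelʳ-≤ (#d k) 1 (#unpaired ps k) (subst₂ _≤_ #d-suc #u-suc dyck))
    where
    #d-suc : #d (suc k) ≡ 1 + #d k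
    #d-suc = trans (count-take-suc d P k k<len) (trans (cong (λ x → #d k + count d [ x ]) letter-d) (+-comm (#d k) 1))
    #u-suc : #u (suc k) ≡ #unpaired ps k + #d k
    #u-suc = trans (count-take-suc u P k k<len) (trans (cong (λ x → #u k + count u [ x ]) letter-d)
                   (trans (+-identityʳ (#u k)) (sym (balance I))))

  invariant-down-up : ∀ {k ps l} → Invariant k ps → k < M → k < length P → letterAt P k ≡ d →
                      ∀ {j} → j < k → isPaired ps (appℕ σ j) ≡ false →
                      PrefixInterval k l → suc (rot (appℕ σ k)) ≡ l → Invariant (suc k) (invStep σ ps k)
  invariant-down-up {k} {ps} {l} I k<M k<len letter-d {j} j<k j-free Iₖ 1+s≡l =
    subst (Invariant (suc k)) (sym (invStep-up ps k adjacent found)) (extend-up s<v between-paired s-below)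
    where
    open PrefixInterval Iₖ
    1≤k : 1 ≤ k
    1≤k = ≤-trans (s≤s z≤n) j<k
    adjacent : adjacentUp k ≡ true
    adjacent = proj₁ (upward 1≤k Iₖ 1+s≡l)
    route : ∀ i → i < k → rot (upRoute k i) ≡ l + i
    route = proj₂ (upward 1≤k Iₖ 1+s≡l)
    on-route : ∀ {y} → y < M → l ≤ rot y → rot y < l + k → ∃ λ i → i < k × upRoute k i ≡ y × rot y ≡ l + i
    on-route = route-hits (upRoute k) (λ i → m%n<n (suc (appℕ σ k) + i) M) route
    σj-on-route : ∃ λ i → i < k × upRoute k i ≡ appℕ σ j × rot (appℕ σ j) ≡ l + i
    σj-on-route = on-route (appℕ<M j) (proj₁ (bounds (j , j<k , refl))) (proj₂ (bounds (j , j<k , refl)))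
    open FirstUnpaired (firstUnpaired-applyUpTo ps (upRoute k) k (proj₁ σj-on-route) (proj₁ (proj₂ σj-on-route))
                          (subst (λ y → isPaired ps y ≡ false) (sym (proj₁ (proj₂ (proj₂ σj-on-route)))) j-free))
    v = upRoute k index
    rot-v : rot v ≡ l + index
    rot-v = route index index<k
    v∈ : InPrefixℕ k v
    v∈ = complete (m%n<n (suc (appℕ σ k) + index) M) (subst (l ≤_) (sym rot-v) (m≤m+n l index))
                                                   (subst (_< l + k) (sym rot-v) (+-monoʳ-< l index<k))
    open Extend I k<M k<len letter-d v∈ (unpaired⇒partnerOf≡nothing ps v unpaired)
    s<v : rot s < rot v
    s<v = subst (_≤ rot v) (sym 1+s≡l) (subst (l ≤_) (sym rot-v) (m≤m+n l index))
    between-paired : ∀ {y} → y < M → rot s < rot y → rot y < rot v → ∃ λ z → partnerOf ps y ≡ just z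
    between-paired {y} y<M s<y y<v =
      paired⇒partnerOf≡just ps y
        (subst (λ x → isPaired ps x ≡ true) (proj₁ (proj₂ (proj₂ hit))) (earlier-paired (proj₁ hit) i<index))
      where
      hit : ∃ λ i → i < k × upRoute k i ≡ y × rot y ≡ l + i
      hit = on-route y<M (subst (_≤ rot y) 1+s≡l s<y) (<-trans y<v (proj₂ (bounds v∈)))
      i<index : proj₁ hit < index
      i<index = +-cancelˡ-< l (proj₁ hit) index (subst₂ _<_ (proj₂ (proj₂ (proj₂ hit))) rot-v y<v)
    s-below : ∀ {z} → InPrefixℕ k z → rot s < rot z
    s-below z∈ = subst (_≤ _) (sym 1+s≡l) (proj₁ (bounds z∈))


  invariant-down-down : ∀ {k ps l} → Invariant k ps → k < M → k < length P → letterAt P k ≡ d →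
                        ∀ {j} → j < k → isPaired ps (appℕ σ j) ≡ false →
                        PrefixInterval k l → rot (appℕ σ k) ≡ l + k → Invariant (suc k) (invStep σ ps k)
  invariant-down-down {k} {ps} {l} I k<M k<len letter-d {j} j<k j-free Iₖ s≡l+k =
    subst (Invariant (suc k)) (sym (invStep-down ps k adjacent found)) (extend-down v<s between-paired s-above)
    where
    open PrefixInterval Iₖ
    adjacent : adjacentUp k ≡ false
    adjacent = proj₁ (downward Iₖ s≡l+k)
    route : ∀ i → i < k → rot (downRoute k i) ≡ l + (k ∸ suc i)
    route = proj₂ (downward Iₖ s≡l+k)
    -- the route read backwards, so that it climbs from l to l + k - 1
    backwards : ℕ → ℕ
    backwards i = downRoute k (k ∸ suc i)
    on-route : ∀ {y} → y < M → l ≤ rot y → rot y < l + k → ∃ λ i → i < k × backwards i ≡ y × rot y ≡ l + i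
    on-route = route-hits backwards (λ i → m%n<n (appℕ σ k + (M ∸ suc (k ∸ suc i))) M)
                 (λ i i<k → trans (route (k ∸ suc i) (∸-suc-< i<k)) (cong (l +_) (∸-suc-involutive i<k)))
    σj-on-route : ∃ λ i → i < k × backwards i ≡ appℕ σ j × rot (appℕ σ j) ≡ l + i
    σj-on-route = on-route (appℕ<M j) (proj₁ (bounds (j , j<k , refl))) (proj₂ (bounds (j , j<k , refl)))
    open FirstUnpaired (firstUnpaired-applyUpTo ps (downRoute k) k (k ∸ suc (proj₁ σj-on-route))
                          (∸-suc-< (proj₁ (proj₂ σj-on-route)))
                          (subst (λ y → isPaired ps y ≡ false) (sym (proj₁ (proj₂ (proj₂ σj-on-route)))) j-free))
    v = downRoute k index
    rot-v : rot v ≡ l + (k ∸ suc index)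
    rot-v = route index index<k
    v<l+k : rot v < l + k
    v<l+k = subst (_< l + k) (sym rot-v) (+-monoʳ-< l (∸-suc-< index<k))
    v∈ : InPrefixℕ k v
    v∈ = complete (m%n<n (appℕ σ k + (M ∸ suc index)) M) (subst (l ≤_) (sym rot-v) (m≤m+n l _)) v<l+k
    open Extend I k<M k<len letter-d v∈ (unpaired⇒partnerOf≡nothing ps v unpaired)
    v<s : rot v < rot s
    v<s = subst (rot v <_) (sym s≡l+k) v<l+k
    between-paired : ∀ {y} → y < M → rot v < rot y → rot y < rot s → ∃ λ z → partnerOf ps y ≡ just z
    between-paired {y} y<M v<y y<s =
      paired⇒partnerOf≡just ps y (subst (λ x → isPaired ps x ≡ true) (proj₁ (proj₂ (proj₂ hit)))
                                         (earlier-paired (k ∸ suc (proj₁ hit)) before))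
      where
      hit : ∃ λ i → i < k × backwards i ≡ y × rot y ≡ l + i
      hit = on-route y<M (≤-trans (proj₁ (bounds v∈)) (<⇒≤ v<y)) (subst (rot y <_) s≡l+k y<s)
      before : k ∸ suc (proj₁ hit) < index
      before = ∸-suc-cancel-< k (subst (k ∸ suc index <_) (sym (∸-suc-involutive (proj₁ (proj₂ hit))))
                                  (+-cancelˡ-< l _ (proj₁ hit) (subst₂ _<_ rot-v (proj₂ (proj₂ (proj₂ hit))) v<y)))
    s-above : ∀ {z} → InPrefixℕ k z → rot z < rot s
    s-above {z} z∈ = subst (rot z <_) (sym s≡l+k) (proj₂ (bounds z∈))

  invariant-down : ∀ {k ps} → Invariant k ps → k < M → k < length P → letterAt P k ≡ d →
                   #d (suc k) ≤ #u (suc k) → Invariant (suc k) (invStep σ ps k)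
  invariant-down {k} {ps} I k<M k<len letter-d dyck = by-side (adjacent-endpoint 1≤k (≤-pred k<M) Iₖ)
    where
    unpaired : ∃ λ j → j < k × isPaired ps (appℕ σ j) ≡ false
    unpaired = some-unpaired I k<len letter-d dyck
    j<k : proj₁ unpaired < k
    j<k = proj₁ (proj₂ unpaired)
    1≤k : 1 ≤ k
    1≤k = ≤-trans (s≤s z≤n) j<k
    l : ℕ
    l = proj₁ (prefix-interval k 1≤k (≤-pred k<M))
    Iₖ : PrefixInterval k l
    Iₖ = proj₂ (prefix-interval k 1≤k (≤-pred k<M))
    by-side : suc (rot (appℕ σ k)) ≡ l ⊎ rot (appℕ σ k) ≡ l + k → Invariant (suc k) (invStep σ ps k)
    by-side (inj₁ 1+s≡l) = invariant-down-up   I k<M k<len letter-d j<k (proj₂ (proj₂ unpaired)) Iₖ 1+s≡l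
    by-side (inj₂ s≡l+k) = invariant-down-down I k<M k<len letter-d j<k (proj₂ (proj₂ unpaired)) Iₖ s≡l+k

module InverseAlgorithmOutput {m' : ℕ} (σ : Permutation′ (suc m')) (σ-ccp : IsCCP σ) (1≤m' : 1 ≤ m')
                              (P : List Step) (|P|≡M : length P ≡ suc m') (balanced : count u P ≡ count d P)
                              (prefix-ok : ∀ k → count d (take k P) ≤ count u (take k P)) where

  open CCPGeometry σ σ-ccp 1≤m'
  open InverseAlgorithmInvariant σ σ-ccp 1≤m' P
  open Invariant

  run : ℕ → Pairs
  run zero    = []
  run (suc k) = invLoop P σ (run k) k

  foldl-run : ∀ k → foldl (invLoop P σ) [] (upTo k) ≡ run k
  foldl-run zero    = refl
  foldl-run (suc k) = begin
    foldl (invLoop P σ) [] (upTo (suc k))        ≡⟨ cong (foldl (invLoop P σ) []) (upTo-∷ʳ k) ⟨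
    foldl (invLoop P σ) [] (upTo k ++ [ k ])     ≡⟨ foldl-∷ʳ (invLoop P σ) [] k (upTo k) ⟩
    invLoop P σ (foldl (invLoop P σ) [] (upTo k)) k ≡⟨ cong (λ ps → invLoop P σ ps k) (foldl-run k) ⟩
    run (suc k)                                  ∎
    where open ≡-Reasoning

  invariant-run : ∀ k → k ≤ M → Invariant k (run k)
  invariant-run zero    _   = invariant-start
  invariant-run (suc k) k<M with letterAt P k in letter
  ... | u = invariant-up   (invariant-run k (<⇒≤ k<M)) k<M (subst (k <_) (sym |P|≡M) k<M) letter
  ... | d = invariant-down (invariant-run k (<⇒≤ k<M)) k<M (subst (k <_) (sym |P|≡M) k<M) letter (prefix-ok (suc k))

  final : Pairs
  final = run M

  I : Invariant M final
  I = invariant-run M ≤-refl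

  all-paired : ∀ {y} → y < M → ∃ λ z → partnerOf final y ≡ just z
  all-paired {y} y<M with appℕ-surjective y<M
  ... | j , j<M , σj≡y = paired⇒partnerOf≡just final y
          (subst (λ x → isPaired final x ≡ true) σj≡y (countFalse≡0 _ M none j j<M))
    where
    P-whole : take M P ≡ P
    P-whole = take-all M P (≤-reflexive |P|≡M)
    none : #unpaired final M ≡ 0
    none = +-cancelʳ-≡ (#d M) (#unpaired final M) 0
             (trans (balance I) (trans (cong (count u) P-whole) (trans balanced (cong (count d) (sym P-whole)))))

  paired<M : ∀ {y z} → partnerOf final y ≡ just z → y < M
  paired<M e = InPrefixℕ⇒<M (within I e)

  partner<M : ∀ {y z} → partnerOf final y ≡ just z → z < M
  partner<M e = paired<M (symmetric I e)

  partner-unique : ∀ {y z z'} → partnerOf final y ≡ just z → partnerOf final y ≡ just z' → z ≡ z'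
  partner-unique e e' = just-injective (trans (sym e) e')

  τ : Fin M → Fin M
  τ = pairsToFun final

  τ-partner : ∀ i → partnerOf final (toℕ i) ≡ just (toℕ (τ i))
  τ-partner i = trans e (cong just (sym (toℕ-pairsToFun final i e (partner<M e))))
    where
    e : partnerOf final (toℕ i) ≡ just (proj₁ (all-paired (toℕ<n i)))
    e = proj₂ (all-paired (toℕ<n i))

  τ-isPairing : IsPairing τ
  τ-isPairing = no-fixed-point , involutive
    where
    no-fixed-point : ∀ i → ¬ τ i ≡ i
    no-fixed-point i τi≡i = irreflexive I (τ-partner i) (cong toℕ (sym τi≡i))
    involutive : ∀ i → τ (τ i) ≡ i
    involutive i = toℕ-injective (just-injective (trans (sym (τ-partner (τ i))) (symmetric I (τ-partner i))))

  Between : ℕ → ℕ → ℕ → Set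
  Between a b t = rot a ≤ rot t × rot t ≤ rot b

  arc-interval-closed : ∀ {a b y z} → partnerOf final a ≡ just b → partnerOf final y ≡ just z →
                        rot a ≤ rot y → rot y ≤ rot b → Between a b z
  arc-interval-closed {a} {b} {y} {z} ea ey a≤y y≤b with m≤n⇒m<n∨m≡n a≤y | m≤n⇒m<n∨m≡n y≤b
  ... | inj₂ a≡y | _ = subst (Between a b) (partner-unique ea' ey) (≤-trans a≤y y≤b , ≤-refl)
    where
    ea' : partnerOf final y ≡ just b
    ea' = subst (λ t → partnerOf final t ≡ just b) (rot-injective (paired<M ea) (paired<M ey) a≡y) ea
  ... | inj₁ _ | inj₂ y≡b = subst (Between a b) (partner-unique eb ey) (≤-refl , ≤-trans a≤y y≤b)
    where
    eb : partnerOf final y ≡ just a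
    eb = subst (λ t → partnerOf final t ≡ just a) (rot-injective (partner<M ea) (paired<M ey) (sym y≡b)) (symmetric I ea)
  ... | inj₁ a<y | inj₁ y<b with nested I ea a<y y<b (paired<M ey)
  ...   | z' , ez' , a<z' , z'<b = subst (Between a b) (partner-unique ez' ey) (<⇒≤ a<z' , <⇒≤ z'<b)

  arc-outside-closed : ∀ {a b y z} → partnerOf final a ≡ just b → partnerOf final y ≡ just z →
                       rot b ≤ rot y ⊎ rot y ≤ rot a → rot b ≤ rot z ⊎ rot z ≤ rot a
  arc-outside-closed {a} {b} {y} {z} ea ey y-out with rot b ≤? rot z | rot z ≤? rot a
  ... | yes b≤z | _       = inj₁ b≤z
  ... | no  _   | yes z≤a = inj₂ z≤a
  ... | no  b≰z | no  z≰a with nested I ea (≰⇒> z≰a) (≰⇒> b≰z) (partner<M ey)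
  ...   | y' , ey' , a<y' , y'<b with partner-unique ey' (symmetric I ey) | y-out
  ...     | refl | inj₁ b≤y = ⊥-elim (<⇒≱ y'<b b≤y)
  ...     | refl | inj₂ y≤a = ⊥-elim (<⇒≱ a<y' y≤a)

  block-closed : ∀ {A k' y z} → suc k' ≤ M → partnerOf final A ≡ just ((A + k') % M) →
                 partnerOf final y ≡ just z → InBlockℕ A (suc k') y → InBlockℕ A (suc k') z
  block-closed {A} {k'} {y} {z} k≤M eA ey y∈ = by-wrap (rot A + k' <? M)
    where
    E = (A + k') % M
    by-wrap : Dec (rot A + k' < M) → InBlockℕ A (suc k') z
    by-wrap (yes no-wrap) =
      unwrapped-block-complete {A} {k'} (partner<M ey) (proj₁ z-in) (subst (rot z ≤_) rot-E (proj₂ z-in))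
      where
      rot-E : rot E ≡ rot A + k'
      rot-E = trans (rot-+ A k') (m<n⇒m%n≡m no-wrap)
      y-in : rot A ≤ rot y × rot y ≤ rot A + k'
      y-in = unwrapped-block {A} {k'} no-wrap y∈
      z-in : rot A ≤ rot z × rot z ≤ rot E
      z-in = arc-interval-closed eA ey (proj₁ y-in) (subst (rot y ≤_) (sym rot-E) (proj₂ y-in))
    -- a wrapping block is the complement of the points strictly between E and A
    by-wrap (no A+k'≮M) =
      wrapped-block-complete {A} {k'} wrap (partner<M ey)
        (map₂ (subst (rot z ≤_) rot-E) (arc-outside-closed (symmetric I eA) ey y-out))
      where
      wrap : M ≤ rot A + k'
      wrap = ≮⇒≥ A+k'≮M
      rot-E : rot E ≡ rot A + k' ∸ M
      rot-E = trans (rot-+ A k') (%-wrap wrap (+-mono-< (rot<M A) k≤M))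
      y-out : rot A ≤ rot y ⊎ rot y ≤ rot E
      y-out = map₂ (subst (rot y ≤_) (sym rot-E)) (wrapped-block {A} {k'} wrap k≤M y∈)

  τ-nonCrossing : NonCrossing τ
  τ-nonCrossing c x (suc k') _ k≤M endpoints c' c'∈ = block-closed k≤M (arc endpoints) (τ-partner c') c'∈
    where
    arc : (toℕ x ≡ toℕ c × (toℕ x + k') % M ≡ toℕ (τ c)) ⊎
          (toℕ x ≡ toℕ (τ c) × (toℕ x + k') % M ≡ toℕ c) →
          partnerOf final (toℕ x) ≡ just ((toℕ x + k') % M)
    arc (inj₁ (x≡c , E≡τc)) = subst₂ (λ a b → partnerOf final a ≡ just b) (sym x≡c) (sym E≡τc) (τ-partner c)
    arc (inj₂ (x≡τc , E≡c)) =
      subst₂ (λ a b → partnerOf final a ≡ just b) (sym x≡τc) (sym E≡c) (symmetric I (τ-partner c))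

inverseAlgorithm-noncrossing : ∀ {m'} (σ : Permutation′ (suc m')) → IsCCP σ → 1 ≤ m' →
  ∀ P → length P ≡ suc m' → count u P ≡ count d P → (∀ k → count d (take k P) ≤ count u (take k P)) →
  IsPairing (inverseAlgorithm P σ) × NonCrossing (inverseAlgorithm P σ)
inverseAlgorithm-noncrossing {m'} σ σ-ccp 1≤m' P |P|≡M balanced prefix-ok =
  subst (λ f → IsPairing f × NonCrossing f) (sym (cong pairsToFun (foldl-run (suc m')))) (τ-isPairing , τ-nonCrossing)
  where open InverseAlgorithmOutput σ σ-ccp 1≤m' P |P|≡M balanced prefix-ok

module NonCrossingTunneling {m' : ℕ} (τ : Fin (suc m') → Fin (suc m')) (τ-pairing : IsPairing τ)
                            (τ-nc : NonCrossing τ) where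

  M : ℕ
  M = suc m'

  τℕ : ℕ → ℕ
  τℕ x with x <? M
  ... | yes x<M = toℕ (τ (fromℕ< x<M))
  ... | no  _   = 0

  τℕ-toℕ : ∀ i → τℕ (toℕ i) ≡ toℕ (τ i)
  τℕ-toℕ i with toℕ i <? M
  ... | yes i<M = cong (λ j → toℕ (τ j)) (fromℕ<-toℕ i i<M)
  ... | no  i≮M = ⊥-elim (i≮M (toℕ<n i))

  τℕ<M : ∀ x → τℕ x < M
  τℕ<M x with x <? M
  ... | yes _ = toℕ<n _
  ... | no  _ = s≤s z≤n

  τℕ-fromℕ< : ∀ {x} (x<M : x < M) → τℕ x ≡ toℕ (τ (fromℕ< x<M))
  τℕ-fromℕ< x<M = trans (cong τℕ (sym (toℕ-fromℕ< x<M))) (τℕ-toℕ (fromℕ< x<M))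

  τℕ-involutive : ∀ {x} → x < M → τℕ (τℕ x) ≡ x
  τℕ-involutive {x} x<M = begin
    τℕ (τℕ x)                      ≡⟨ cong τℕ (τℕ-fromℕ< x<M) ⟩
    τℕ (toℕ (τ (fromℕ< x<M)))      ≡⟨ τℕ-toℕ (τ (fromℕ< x<M)) ⟩
    toℕ (τ (τ (fromℕ< x<M)))       ≡⟨ cong toℕ (proj₂ τ-pairing (fromℕ< x<M)) ⟩
    toℕ (fromℕ< x<M)               ≡⟨ toℕ-fromℕ< x<M ⟩
    x                              ∎
    where open ≡-Reasoning

  τℕ-no-fixed-point : ∀ {x} → x < M → τℕ x ≢ x
  τℕ-no-fixed-point x<M τx≡x =
    proj₁ τ-pairing (fromℕ< x<M) (toℕ-injective (trans (sym (τℕ-fromℕ< x<M)) (trans τx≡x (sym (toℕ-fromℕ< x<M)))))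

  τℕ-swap : ∀ {x p} → x < M → τℕ x ≡ p → x ≡ τℕ p
  τℕ-swap x<M τx≡p = trans (sym (τℕ-involutive x<M)) (cong τℕ τx≡p)

  -- The block a, a+1, …, τ a does not wrap around, and it is closed under τ.
  nested-arcs : ∀ {a c} → a < c → c < τℕ a → a < τℕ c × τℕ c < τℕ a
  nested-arcs {a} {c} a<c c<b = a<τc , τc<b
    where
    b = τℕ a
    c<M : c < M
    c<M = <-trans c<b (τℕ<M a)
    a<M : a < M
    a<M = <-trans a<c c<M
    a+[b∸a]≡b : a + (b ∸ a) ≡ b
    a+[b∸a]≡b = m+[n∸m]≡n (<⇒≤ (<-trans a<c c<b))
    x = fromℕ< a<M
    x≡a : toℕ x ≡ a
    x≡a = toℕ-fromℕ< a<M
    end≡τx : (toℕ x + (b ∸ a)) % M ≡ toℕ (τ x)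
    end≡τx = trans (cong (λ t → (t + (b ∸ a)) % M) x≡a)
                   (trans (cong (_% M) a+[b∸a]≡b) (trans (m<n⇒m%n≡m (τℕ<M a)) (τℕ-fromℕ< a<M)))
    c∈ : InBlock x (suc (b ∸ a)) (fromℕ< c<M)
    c∈ = c ∸ a , s≤s (∸-monoˡ-≤ a (<⇒≤ c<b)) ,
         trans (toℕ-fromℕ< c<M) (sym (trans (cong (λ t → (t + (c ∸ a)) % M) x≡a)
                                             (trans (cong (_% M) (m+[n∸m]≡n (<⇒≤ a<c))) (m<n⇒m%n≡m c<M))))
    block-size≤M : suc (b ∸ a) ≤ M
    block-size≤M = ≤-trans (s≤s (subst (b ∸ a ≤_) a+[b∸a]≡b (m≤n+m (b ∸ a) a))) (τℕ<M a)
    τc∈ : InBlock x (suc (b ∸ a)) (τ (fromℕ< c<M))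
    τc∈ = τ-nc x x (suc (b ∸ a)) (s≤s z≤n) block-size≤M (inj₁ (refl , end≡τx)) (fromℕ< c<M) c∈
    j = proj₁ τc∈
    j≤b∸a : j ≤ b ∸ a
    j≤b∸a = ≤-pred (proj₁ (proj₂ τc∈))
    τc≡a+j : τℕ c ≡ a + j
    τc≡a+j = trans (τℕ-fromℕ< c<M) (trans (proj₂ (proj₂ τc∈)) (trans (cong (λ t → (t + j) % M) x≡a)
               (m<n⇒m%n≡m (≤-<-trans (subst (a + j ≤_) a+[b∸a]≡b (+-monoʳ-≤ a j≤b∸a)) (τℕ<M a)))))
    a≤τc : a ≤ τℕ c
    a≤τc = subst (a ≤_) (sym τc≡a+j) (m≤m+n a j)
    τc≤b : τℕ c ≤ b
    τc≤b = subst₂ _≤_ (sym τc≡a+j) a+[b∸a]≡b (+-monoʳ-≤ a j≤b∸a)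
    a<τc : a < τℕ c
    a<τc = ≤∧≢⇒< a≤τc (λ a≡τc → <-irrefl (τℕ-swap c<M (sym a≡τc)) c<b)
    τc<b : τℕ c < b
    τc<b = ≤∧≢⇒< τc≤b (λ τc≡b → <-irrefl (trans (sym (τℕ-involutive a<M)) (sym (τℕ-swap c<M τc≡b))) a<c)

  step : ℕ → Step
  step p with p <? τℕ p
  ... | yes _ = u
  ... | no  _ = d

  step-u : ∀ {p} → p < τℕ p → step p ≡ u
  step-u {p} p<τp with p <? τℕ p
  ... | yes _   = refl
  ... | no  p≮τp = ⊥-elim (p≮τp p<τp)

  step-d : ∀ {p} → τℕ p < p → step p ≡ d
  step-d {p} τp<p with p <? τℕ p
  ... | yes p<τp = ⊥-elim (<-asym p<τp τp<p)
  ... | no  _    = refl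

  steps : ℕ → ℕ → List Step
  steps a zero    = []
  steps a (suc r) = step a ∷ steps (suc a) r

  Q : List Step
  Q = steps 0 M

  push-pop : Step → ℕ → List ℕ → List ℕ
  push-pop u p st       = p ∷ st
  push-pop d p []       = []
  push-pop d p (_ ∷ st) = st

  -- the stack of tunnelPairs after reading the first p steps of Q
  stack : ℕ → List ℕ
  stack zero    = []
  stack (suc p) = push-pop (step p) p (stack p)

  stack-u : ∀ {p} → step p ≡ u → stack (suc p) ≡ p ∷ stack p
  stack-u {p} e rewrite e = refl

  stack-d : ∀ {p h rest} → step p ≡ d → stack p ≡ h ∷ rest → stack (suc p) ≡ rest
  stack-d {p} e e' rewrite e | e' = refl

  OpenAt : ℕ → ℕ → Set
  OpenAt p x = x < p × x < τℕ x × p ≤ τℕ x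

  record OpenStack (p : ℕ) (st : List ℕ) : Set where
    field
      only-open  : ∀ {x} → x ∈ st → OpenAt p x
      all-open   : ∀ {x} → OpenAt p x → x ∈ st
      decreasing : AllPairs _>_ st

  push-open : ∀ {p st} → p < M → p < τℕ p → OpenStack p st → OpenStack (suc p) (p ∷ st)
  push-open {p} {st} p<M p<τp S = record
    { only-open = only-open' ; all-open = all-open'
    ; decreasing = All.tabulate (λ x∈ → proj₁ (only-open x∈)) ∷ decreasing }
    where
    open OpenStack S
    only-open' : ∀ {x} → x ∈ p ∷ st → OpenAt (suc p) x
    only-open' (here refl) = ≤-refl , p<τp , p<τp
    only-open' (there x∈) with only-open x∈
    ... | x<p , x<τx , p≤τx = <-trans x<p (n<1+n p) , x<τx ,
          ≤∧≢⇒< p≤τx (λ p≡τx → <-asym x<p (subst (p <_) (sym (τℕ-swap (<-trans x<p p<M) (sym p≡τx))) p<τp))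
    all-open' : ∀ {x} → OpenAt (suc p) x → x ∈ p ∷ st
    all-open' (x<1+p , x<τx , 1+p≤τx) with m≤n⇒m<n∨m≡n (≤-pred x<1+p)
    ... | inj₂ refl = here refl
    ... | inj₁ x<p  = there (all-open (x<p , x<τx , <⇒≤ 1+p≤τx))

  closing-open : ∀ {p} → p < M → τℕ p < p → OpenAt p (τℕ p)
  closing-open {p} p<M τp<p = τp<p , subst (τℕ p <_) (sym ττp≡p) τp<p , subst (p ≤_) (sym ττp≡p) ≤-refl
    where
    ττp≡p : τℕ (τℕ p) ≡ p
    ττp≡p = τℕ-involutive p<M

  -- the arc closing at p is the innermost open one, hence on top of the stack
  pop-top : ∀ {p st} → p < M → τℕ p < p → OpenStack p st → ∃ λ rest → st ≡ τℕ p ∷ rest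
  pop-top {p} {[]} p<M τp<p S with OpenStack.all-open S (closing-open p<M τp<p)
  ... | ()
  pop-top {p} {h ∷ rest} p<M τp<p S with OpenStack.all-open S (closing-open p<M τp<p)
  ... | here τp≡h = rest , cong (_∷ rest) (sym τp≡h)
  ... | there τp∈rest with OpenStack.only-open S (here refl) | OpenStack.decreasing S
  ...   | h<p , _ , p≤τh | τp<rest ∷ _ =
    ⊥-elim (<⇒≱ (subst (τℕ h <_) (τℕ-involutive p<M) (proj₂ (nested-arcs (All.lookup τp<rest τp∈rest)
                                                         (subst (h <_) (sym (τℕ-involutive p<M)) h<p))))
                p≤τh)

  pop-open : ∀ {p rest} → p < M → τℕ p < p → OpenStack p (τℕ p ∷ rest) → OpenStack (suc p) rest
  pop-open {p} {rest} p<M τp<p S = record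
    { only-open = only-open' ; all-open = all-open' ; decreasing = decreasing-rest }
    where
    open OpenStack S
    below-top : All (τℕ p >_) rest
    below-top with decreasing
    ... | b ∷ _ = b
    decreasing-rest : AllPairs _>_ rest
    decreasing-rest with decreasing
    ... | _ ∷ decreasing-rest = decreasing-rest
    only-open' : ∀ {x} → x ∈ rest → OpenAt (suc p) x
    only-open' x∈ with only-open (there x∈)
    ... | x<p , x<τx , p≤τx = <-trans x<p (n<1+n p) , x<τx ,
          ≤∧≢⇒< p≤τx (λ p≡τx → <-irrefl (τℕ-swap (<-trans x<p p<M) (sym p≡τx)) (All.lookup below-top x∈))
    all-open' : ∀ {x} → OpenAt (suc p) x → x ∈ rest
    all-open' (x<1+p , x<τx , 1+p≤τx) with m≤n⇒m<n∨m≡n (≤-pred x<1+p)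
    ... | inj₂ refl = ⊥-elim (<-asym x<τx τp<p)
    ... | inj₁ x<p with all-open (x<p , x<τx , <⇒≤ 1+p≤τx)
    ...   | there x∈ = x∈
    ...   | here refl = ⊥-elim (<-irrefl (sym (τℕ-involutive p<M)) 1+p≤τx)

  stack-open : ∀ p → p ≤ M → OpenStack p (stack p)
  stack-open zero    _   = record { only-open = λ () ; all-open = λ x-open → ⊥-elim (n≮0 (proj₁ x-open)) ; decreasing = [] }
  stack-open (suc p) p<M with <-cmp p (τℕ p)
  ... | tri< p<τp _ _ = subst (OpenStack (suc p)) (sym (stack-u (step-u p<τp))) (push-open p<M p<τp (stack-open p (<⇒≤ p<M)))
  ... | tri≈ _ p≡τp _ = ⊥-elim (τℕ-no-fixed-point p<M (sym p≡τp))
  ... | tri> _ _ τp<p with pop-top p<M τp<p (stack-open p (<⇒≤ p<M))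
  ...   | rest , stack≡ = subst (OpenStack (suc p)) (sym (stack-d (step-d τp<p) stack≡))
                                (pop-open p<M τp<p (subst (OpenStack p) stack≡ (stack-open p (<⇒≤ p<M))))

  stack-final : stack M ≡ []
  stack-final with stack M | OpenStack.only-open (stack-open M ≤-refl)
  ... | []    | _         = refl
  ... | x ∷ _ | only-open = ⊥-elim (<⇒≱ (τℕ<M x) (proj₂ (proj₂ (only-open (here refl)))))

  steps-∷ʳ : ∀ a p → steps a (suc p) ≡ steps a p ++ [ step (a + p) ]
  steps-∷ʳ a zero    = cong (λ x → step x ∷ []) (sym (+-identityʳ a))
  steps-∷ʳ a (suc p) =
    cong (step a ∷_) (trans (steps-∷ʳ (suc a) p) (cong (λ x → steps (suc a) p ++ [ step x ]) (sym (+-suc a p))))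

  take-steps : ∀ a p r → p ≤ r → take p (steps a r) ≡ steps a p
  take-steps a zero    r       _         = refl
  take-steps a (suc p) (suc r) (s≤s p≤r) = cong (step a ∷_) (take-steps (suc a) p r p≤r)

  length-steps : ∀ a r → length (steps a r) ≡ r
  length-steps a zero    = refl
  length-steps a (suc r) = cong suc (length-steps (suc a) r)

  #Q : Step → ℕ → ℕ
  #Q s p = count s (steps 0 p)

  #Q-suc : ∀ s p → #Q s (suc p) ≡ #Q s p + count s [ step p ]
  #Q-suc s p = trans (cong (count s) (steps-∷ʳ 0 p)) (count-++ s (steps 0 p) [ step p ])

  stack-height : ∀ p → p ≤ M → length (stack p) + #Q d p ≡ #Q u p
  stack-height zero    _   = refl
  stack-height (suc p) p<M with <-cmp p (τℕ p) | stack-height p (<⇒≤ p<M)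
  ... | tri< p<τp _ _ | IH rewrite stack-u (step-u p<τp) | #Q-suc d p | #Q-suc u p | step-u p<τp =
    trans (shuffle (length (stack p)) (#Q d p)) (cong (_+ 1) IH)
    where
    shuffle : ∀ a b → suc a + (b + 0) ≡ a + b + 1
    shuffle = solve-∀
  ... | tri≈ _ p≡τp _ | _ = ⊥-elim (τℕ-no-fixed-point p<M (sym p≡τp))
  ... | tri> _ _ τp<p | IH with pop-top p<M τp<p (stack-open p (<⇒≤ p<M))
  ...   | rest , stack≡ rewrite stack-d (step-d τp<p) stack≡ | #Q-suc d p | #Q-suc u p | step-d τp<p | stack≡ =
    trans (shuffle (length rest) (#Q d p)) (trans IH (sym (+-identityʳ (#Q u p))))
    where
    shuffle : ∀ a b → a + (b + 1) ≡ suc a + b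
    shuffle = solve-∀

  Q-dyck : ∀ n → n + n ≡ M → IsDyck n Q
  Q-dyck n n+n≡M = #u≡n , trans #d≡#u #u≡n , prefix-ok
    where
    #d≡#u : #Q d M ≡ #Q u M
    #d≡#u = subst (λ st → length st + #Q d M ≡ #Q u M) stack-final (stack-height M ≤-refl)
    #u≡n : count u Q ≡ n
    #u≡n = m+m≡n+n⇒m≡n (begin
      #Q u M + #Q u M  ≡⟨ cong (#Q u M +_) #d≡#u ⟨
      #Q u M + #Q d M  ≡⟨ count-u+count-d Q ⟩
      length Q         ≡⟨ length-steps 0 M ⟩
      M                ≡⟨ n+n≡M ⟨
      n + n            ∎)
      where open ≡-Reasoning
    prefix-ok : ∀ k → count d (take k Q) ≤ count u (take k Q)
    prefix-ok k with k ≤? M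
    ... | yes k≤M rewrite take-steps 0 k M k≤M = subst (#Q d k ≤_) (stack-height k k≤M) (m≤n+m (#Q d k) _)
    ... | no  k≰M rewrite take-all k Q (subst (_≤ k) (sym (length-steps 0 M)) (<⇒≤ (≰⇒> k≰M))) =
      subst (#Q d M ≤_) (stack-height M ≤-refl) (m≤n+m (#Q d M) _)

  tunnel-u : ∀ {p r} → step p ≡ u →
             tunnelPairs (steps p (suc r)) p (stack p) ≡ tunnelPairs (steps (suc p) r) (suc p) (stack (suc p))
  tunnel-u e rewrite e = refl

  tunnel-d : ∀ {p r rest} → step p ≡ d → stack p ≡ τℕ p ∷ rest →
             tunnelPairs (steps p (suc r)) p (stack p) ≡ (τℕ p , p) ∷ tunnelPairs (steps (suc p) r) (suc p) (stack (suc p))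
  tunnel-d {p} e stack≡ rewrite stack-d e stack≡ | e | stack≡ = refl

  tunnel : ∀ r p → p + r ≡ M → ∀ {x} → x < M → p ≤ x ⊎ p ≤ τℕ x →
           partnerOf (tunnelPairs (steps p r) p (stack p)) x ≡ just (τℕ x)
  tunnel zero p p+0≡M {x} x<M (inj₁ p≤x)  = ⊥-elim (<⇒≱ x<M (subst (_≤ x) (trans (sym (+-identityʳ p)) p+0≡M) p≤x))
  tunnel zero p p+0≡M {x} x<M (inj₂ p≤τx) =
    ⊥-elim (<⇒≱ (τℕ<M x) (subst (_≤ τℕ x) (trans (sym (+-identityʳ p)) p+0≡M) p≤τx))
  tunnel (suc r) p p+1+r≡M {x} x<M reached with <-cmp p (τℕ p)
  ... | tri< p<τp _ _ = trans (cong (λ ps → partnerOf ps x) (tunnel-u (step-u p<τp))) (tunnel r (suc p) 1+p+r≡M x<M advance)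
    where
    1+p+r≡M : suc p + r ≡ M
    1+p+r≡M = trans (sym (+-suc p r)) p+1+r≡M
    advance : suc p ≤ x ⊎ suc p ≤ τℕ x
    advance with p ≟ x | p ≟ τℕ x
    ... | yes p≡x | _        = inj₂ (subst (λ t → p < τℕ t) p≡x p<τp)
    ... | no  _   | yes p≡τx = inj₁ (subst (p <_) (sym (τℕ-swap x<M (sym p≡τx))) p<τp)
    ... | no  p≢x | no  p≢τx = map-⊎ (λ p≤x → ≤∧≢⇒< p≤x p≢x) (λ p≤τx → ≤∧≢⇒< p≤τx p≢τx) reached
  ... | tri≈ _ p≡τp _ = ⊥-elim (τℕ-no-fixed-point p<M (sym p≡τp))
    where
    p<M : p < M
    p<M = subst (p <_) p+1+r≡M (m<m+n p (s≤s z≤n))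
  ... | tri> _ _ τp<p with pop-top p<M τp<p (stack-open p (<⇒≤ p<M))
    where
    p<M : p < M
    p<M = subst (p <_) p+1+r≡M (m<m+n p (s≤s z≤n))
  ...   | rest , stack≡ = trans (cong (λ ps → partnerOf ps x) (tunnel-d (step-d τp<p) stack≡)) close
    where
    p<M : p < M
    p<M = subst (p <_) p+1+r≡M (m<m+n p (s≤s z≤n))
    1+p+r≡M : suc p + r ≡ M
    1+p+r≡M = trans (sym (+-suc p r)) p+1+r≡M
    later : Pairs
    later = tunnelPairs (steps (suc p) r) (suc p) (stack (suc p))
    close : partnerOf ((τℕ p , p) ∷ later) x ≡ just (τℕ x)
    close with τℕ p ≟ x | p ≟ x
    ... | yes refl | _        = trans (partnerOf-fst (τℕ p) p later) (cong just (sym (τℕ-involutive p<M)))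
    ... | no  τp≢x | yes refl = partnerOf-snd later (<⇒≢ τp<p)
    ... | no  τp≢x | no  p≢x  = trans (partnerOf-other later τp≢x p≢x) (tunnel r (suc p) 1+p+r≡M x<M advance)
      where
      advance : suc p ≤ x ⊎ suc p ≤ τℕ x
      advance = map-⊎ (λ p≤x → ≤∧≢⇒< p≤x p≢x)
                      (λ p≤τx → ≤∧≢⇒< p≤τx (λ p≡τx → τp≢x (sym (τℕ-swap x<M (sym p≡τx))))) reached

  Q-tunneling : ∀ i → tunneling Q i ≡ τ i
  Q-tunneling i = toℕ-injective (trans
    (toℕ-pairsToFun (tunnelPairs Q 0 []) i (tunnel M 0 refl {toℕ i} (toℕ<n i) (inj₁ z≤n)) (τℕ<M (toℕ i)))
    (τℕ-toℕ i))

noncrossing⇒tunneling : ∀ {m'} n → n + n ≡ suc m' →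
                        (τ : Fin (suc m') → Fin (suc m')) → IsPairing τ → NonCrossing τ →
                        Σ (List Step) (λ Q → IsDyck n Q × (∀ i → tunneling Q i ≡ τ i))
noncrossing⇒tunneling n n+n≡M τ τ-pairing τ-nc = Q , Q-dyck n n+n≡M , Q-tunneling
  where open NonCrossingTunneling τ τ-pairing τ-nc

lemma4 : (n : ℕ) → 1 ≤ n → (σ : Permutation′ (2 * n)) → IsCCP σ →
         (P : List Step) → IsDyck n P →
         IsPairing (inverseAlgorithm P σ) × NonCrossing (inverseAlgorithm P σ)
         × Σ (List Step) (λ Q → IsDyck n Q × (∀ i → tunneling Q i ≡ inverseAlgorithm P σ i))
lemma4 zero    ()
lemma4 (suc n) _  σ σ-ccp P (#u≡n , #d≡n , prefix-ok) =
  pairing , noncrossing , noncrossing⇒tunneling (suc n) n+n≡2n (inverseAlgorithm P σ) pairing noncrossing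
  where
  n+n≡2n : suc n + suc n ≡ 2 * suc n
  n+n≡2n = cong (suc n +_) (sym (+-identityʳ (suc n)))
  |P|≡2n : length P ≡ 2 * suc n
  |P|≡2n = trans (sym (count-u+count-d P)) (trans (cong₂ _+_ #u≡n #d≡n) n+n≡2n)
  1≤2n-1 : 1 ≤ n + suc (n + 0)
  1≤2n-1 = ≤-trans (s≤s z≤n) (m≤n+m (suc (n + 0)) n)
  output : IsPairing (inverseAlgorithm P σ) × NonCrossing (inverseAlgorithm P σ)
  output = inverseAlgorithm-noncrossing σ σ-ccp 1≤2n-1 P |P|≡2n (trans #u≡n (sym #d≡n)) prefix-ok
  pairing = proj₁ output
  noncrossing = proj₂ output
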